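{- Let $\sigma\in\Lambda$ be nonzero. Then in the plethystic bialgebra $\mathcal{P}$, $$\Delta(A_\sigma)=\sum_{\lambda}\sum_{\pmb{\mu}}\frac{\mathrm{aut}(\sigma)\cdot|T^{\pmb{\mu}}_{\sigma,\lambda}|}{\mathrm{aut}(\lambda)\cdot\mathrm{aut}(\pmb{\mu})}\prod_{\mu\in\pmb{\mu}}A_\mu\otimes A_\lambda,$$ where $\lambda$ ranges over nonzero elements of $\Lambda$ and $\pmb{\mu}$ over multisets of $|\lambda|$ nonzero elements of $\Lambda$.
   Context: $\Lambda$ is the set of sequences $\lambda=(\lambda_1,\lambda_2,\dots)$ of nonnegative integers with finitely many nonzero entries; $|\lambda|=\sum_k\lambda_k$; $\mathbf{x}^\lambda=x_1^{\lambda_1}x_2^{\lambda_2}\cdots$; $\mathrm{aut}(\lambda)=\prod_k k!^{\lambda_k}\lambda_k!$; sums in $\Lambda$ are coordinatewise. The Verschiebung operator $V^n$ is $(V^n\lambda)_i=\lambda_{i/n}$ if $n\mid i$ and $0$ otherwise. Power series $F=\sum_{\lambda\ne0}f_\lambda\mathbf{x}^\lambda/\mathrm{aut}(\lambda)\in\mathbb{Q}[[x_1,x_2,\dots]]$; $F_k(x_1,x_2,\dots)=F(x_k,x_{2k},\dots)$; plethystic substitution $G\circledast F=G(F_1,F_2,\dots)$. $A_\lambda(F)=f_\lambda$. $\mathcal{P}=\mathbb{Q}[\{A_\lambda\}_{\lambda\ne0}]$ is the free polynomial algebra, regarded as functions on such power series with pointwise products, with comultiplication determined by $\langle\Delta(A_\lambda),F\otimes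 G\rangle=\langle A_\lambda,G\circledast F\rangle$, where $\langle P\otimes Q,F\otimes G\rangle=P(F)Q(G)$. For a multiset $\pmb{\mu}$ of $m$ elements of $\Lambda$, $\mathrm{rep}(\pmb{\mu})$ is the group of permutations of its $m$ entries fixing each entry's value (so for $\{\alpha,\alpha,\beta,\gamma,\gamma,\gamma\}$ it has $2!\,1!\,3!$ elements), and $\mathrm{aut}(\pmb{\mu})=\prod_{\mu\in\pmb{\mu}}\mathrm{aut}(\mu)\cdot|\mathrm{rep}(\pmb{\mu})|$. Given $\sigma,\lambda$ and $\pmb{\mu}$ with $m=|\lambda|$, list $\pmb{\mu}$ as $(\mu_1,\dots,\mu_m)$; $T^{\pmb{\mu}}_{\sigma,\lambda}$ is the set of bijections $p:\{1,\dots,m\}\to\coprod_{k\ge1}\{1,\dots,\lambda_k\}$ such that $\sigma=\sum_{i=1}^m V^{q(i)}\mu_i$, where $q(i)$ is the index $k$ of the summand containing $p(i)$. -}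

module Defs where

open import Data.Bool using (Bool; true; false; if_then_else_; not; _∧_; T)
open import Data.Unit using (tt)
open import Data.Nat as ℕ using (ℕ; zero; suc; _≡ᵇ_; _<ᵇ_; _∸_; _!; _^_; NonZero)
open import Data.Nat.Properties using (_!≢0; m*n≢0; m^n≢0)
open import Data.Integer using (+_)
open import Data.Rational using (ℚ; 0ℚ; 1ℚ; _/_) renaming (_+_ to _+ℚ_; _*_ to _*ℚ_)
open import Data.List using (List; []; _∷_; map; foldr; concat; concatMap; replicate; _++_; zipWith; length; filter; upTo; deduplicate)
open import Data.Nat.ListAction using (sum; product)
open import Data.List.Relation.Unary.Unique.Propositional using (Unique)
open import Data.List.Membership.Propositional using (_∈_)
open import Data.Product using (Σ; _×_; _,_; proj₁; proj₂)
open import Relation.Nullary using (¬_; Dec; yes; no; does)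
open import Relation.Binary.PropositionalEquality using (_≡_; refl; cong)
import Data.List.Properties as LP

-- An element λ = (λ₁, λ₂, …) with finitely many nonzero entries is
-- represented by the list [λ₁, …, λₙ] WITHOUT trailing zeros (so the
-- representation is unique and _≡_ is the right equality).
-- Position 0 of the list is the variable index k = 1.

normalB : List ℕ → Bool
normalB [] = true
normalB (x ∷ []) = not (x ≡ᵇ 0)
normalB (x ∷ y ∷ ys) = normalB (y ∷ ys)

record Λ : Set where
  constructor mkΛ
  field
    entries : List ℕ
    .normal : T (normalB entries)
open Λ public

consS : ℕ → List ℕ → List ℕ
consS zero [] = []
consS (suc n) [] = suc n ∷ []
consS x (y ∷ ys) = x ∷ y ∷ ys

strip : List ℕ → List ℕ
strip [] = []
strip (x ∷ xs) = consS x (strip xs)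

consS-normal : ∀ x ys → T (normalB ys) → T (normalB (consS x ys))
consS-normal zero [] p = tt
consS-normal (suc n) [] p = tt
consS-normal zero (y ∷ ys) p = p
consS-normal (suc n) (y ∷ ys) p = p

strip-normal : ∀ xs → T (normalB (strip xs))
strip-normal [] = tt
strip-normal (x ∷ xs) = consS-normal x (strip xs) (strip-normal xs)

toΛ : List ℕ → Λ
toΛ xs = mkΛ (strip xs) (strip-normal xs)

0Λ : Λ
0Λ = mkΛ [] tt

_≟Λ_ : (a b : Λ) → Dec (a ≡ b)
mkΛ xs _ ≟Λ mkΛ ys _ with LP.≡-dec ℕ._≟_ xs ys
... | yes refl = yes refl
... | no ne = no (λ eq → ne (cong entries eq))

isZeroΛ : Λ → Bool
isZeroΛ a = does (a ≟Λ 0Λ)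

∣_∣Λ : Λ → ℕ
∣ a ∣Λ = sum (entries a)

zipAdd : List ℕ → List ℕ → List ℕ
zipAdd [] ys = ys
zipAdd (x ∷ xs) [] = x ∷ xs
zipAdd (x ∷ xs) (y ∷ ys) = (x ℕ.+ y) ∷ zipAdd xs ys

_+Λ_ : Λ → Λ → Λ
a +Λ b = toΛ (zipAdd (entries a) (entries b))

autFrom : ℕ → List ℕ → ℕ
autFrom k [] = 1
autFrom k (a ∷ as) = (((k !) ^ a) ℕ.* (a !)) ℕ.* autFrom (suc k) as

autFrom-nz : ∀ k as → NonZero (autFrom k as)
autFrom-nz k [] = _
autFrom-nz k (a ∷ as) =
  m*n≢0 _ _ {{m*n≢0 _ _ {{m^n≢0 (k !) a {{k !≢0}}}} {{a !≢0}}}} {{autFrom-nz (suc k) as}}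

aut : Λ → ℕ
aut a = autFrom 1 (entries a)

aut-nz : ∀ a → NonZero (aut a)
aut-nz a = autFrom-nz 1 (entries a)

-- Verschiebung:  (Vⁿ λ)_i = λ_{i/n} if n ∣ i, else 0   (for n ≥ 1)
V : ℕ → Λ → Λ
V n a = toΛ (concatMap (λ x → replicate (n ∸ 1) 0 ++ (x ∷ [])) (entries a))

-- entry λ_{i+1} (0 beyond the list)
at : List ℕ → ℕ → ℕ
at [] _ = 0
at (x ∷ xs) zero = x
at (x ∷ xs) (suc i) = at xs i

-- the candidate preimage of σ under Vᵏ :  (σ_k, σ_{2k}, …)
contract : ℕ → Λ → Λ
contract k s = toΛ (map (λ j → at (entries s) (k ℕ.* j ∸ 1)) (map suc (upTo (length (entries s)))))

fromℕ : ℕ → ℚ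
fromℕ n = + n / 1

sumℚ : List ℚ → ℚ
sumℚ = foldr _+ℚ_ 0ℚ

productℚ : List ℚ → ℚ
productℚ = foldr _*ℚ_ 1ℚ

-- "Σ_{x ∈ X} t x = s" for a finitely supported family t : X → ℚ:
-- there is a duplicate-free finite list containing the support of t,
-- and the sum of t over it is s.
HasSum : {X : Set} → (X → ℚ) → ℚ → Set
HasSum {X} t s =
  Σ (List X) λ L → Unique L × (∀ x → ¬ (t x ≡ 0ℚ) → x ∈ L) × (sumℚ (map t L) ≡ s)

-- A power series F = Σ_{λ≠0} f_λ x^λ / aut(λ) is given by its family of
-- coefficients f : Λ → ℚ (the value at 0 is ignored: no constant term).
-- Ser below is the family of ORDINARY coefficients (coefficient of x^λ)
-- of a power series with arbitrary constant term.

PowerSeries : Set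
PowerSeries = Λ → ℚ

Ser : Set
Ser = Λ → ℚ

ordinary : PowerSeries → Ser
ordinary f a = if isZeroΛ a then 0ℚ else f a *ℚ ((+ 1 / aut a) {{aut-nz a}})

box : List ℕ → List (List ℕ)
box [] = [] ∷ []
box (x ∷ xs) = concatMap (λ y → map (y ∷_) (box xs)) (upTo (suc x))

_⋆_ : Ser → Ser → Ser
(p ⋆ q) s = sumℚ (map (λ α → p (toΛ α) *ℚ q (toΛ (zipWith _∸_ (entries s) α))) (box (entries s)))

oneSer : Ser
oneSer a = if isZeroΛ a then 1ℚ else 0ℚ

powSer : Ser → ℕ → Ser
powSer p zero = oneSer
powSer p (suc n) = p ⋆ powSer p n

-- H_k(x₁,x₂,…) = H(x_k, x_{2k}, …):  coefficient of x^σ is the coefficient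
-- of x^μ in H if σ = Vᵏ μ (μ is then necessarily contract k σ), else 0.
dilate : ℕ → Ser → Ser
dilate k p s = if does (V k (contract k s) ≟Λ s) then p (contract k s) else 0ℚ

prodDilates : Ser → ℕ → List ℕ → Ser
prodDilates p k [] = oneSer
prodDilates p k (a ∷ as) = powSer (dilate k p) a ⋆ prodDilates p (suc k) as

-- the term of  G ⊛ F = G(F₁,F₂,…) = Σ_{λ≠0} g_λ/aut(λ) ∏_k F_k^{λ_k}
-- contributing to the coefficient of x^σ
plethTerm : PowerSeries → PowerSeries → Λ → Λ → ℚ
plethTerm f g s a =
  if isZeroΛ a then 0ℚ
  else (g a *ℚ ((+ 1 / aut a) {{aut-nz a}})) *ℚ prodDilates (ordinary f) 1 (entries a) s

-- A_σ(G ⊛ F) = c :   c = aut(σ) · [x^σ] (G ⊛ F)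
PlethCoeff : PowerSeries → PowerSeries → Λ → ℚ → Set
PlethCoeff f g s c = Σ ℚ λ t → HasSum (plethTerm f g s) t × (c ≡ fromℕ (aut s) *ℚ t)

-- Multisets of elements of Λ, represented canonically as lists sorted
-- w.r.t. the (total) lexicographic order on entry lists.

leqL : List ℕ → List ℕ → Bool
leqL [] _ = true
leqL (x ∷ xs) [] = false
leqL (x ∷ xs) (y ∷ ys) = if x <ᵇ y then true else (if x ≡ᵇ y then leqL xs ys else false)

sortedB : List Λ → Bool
sortedB [] = true
sortedB (a ∷ []) = true
sortedB (a ∷ b ∷ bs) = leqL (entries a) (entries b) ∧ sortedB (b ∷ bs)

record Multiset : Set where
  constructor mkMS
  field
    elems : List Λ
    .sorted : T (sortedB elems)
open Multiset public

count : Λ → List Λ → ℕ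
count a [] = 0
count a (b ∷ bs) = if does (a ≟Λ b) then suc (count a bs) else count a bs

repSize : Multiset → ℕ
repSize M = product (map (λ a → count a (elems M) !) (deduplicate _≟Λ_ (elems M)))

autMS : Multiset → ℕ
autMS M = product (map aut (elems M)) ℕ.* repSize M

autMS-nz : ∀ M → NonZero (autMS M)
autMS-nz M = m*n≢0 _ _ {{prod-nz (elems M)}} {{prod-fact (deduplicate _≟Λ_ (elems M))}}
  where
  prod-nz : ∀ as → NonZero (product (map aut as))
  prod-nz [] = _
  prod-nz (a ∷ as) = m*n≢0 _ _ {{aut-nz a}} {{prod-nz as}}
  prod-fact : ∀ as → NonZero (product (map (λ a → count a (elems M) !) as))
  prod-fact [] = _
  prod-fact (a ∷ as) = m*n≢0 _ _ {{count a (elems M) !≢0}} {{prod-fact as}}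

-- The sets T^μ_{σ,λ}.
-- ∐_{k≥1} {1,…,λ_k} is the list of pairs (k , j), 1 ≤ j ≤ λ_k (all distinct).
slotsFrom : ℕ → List ℕ → List (ℕ × ℕ)
slotsFrom k [] = []
slotsFrom k (a ∷ as) = map (λ j → (k , suc j)) (upTo a) ++ slotsFrom (suc k) as

slots : Λ → List (ℕ × ℕ)
slots a = slotsFrom 1 (entries a)

insertAll : {A : Set} → A → List A → List (List A)
insertAll x [] = (x ∷ []) ∷ []
insertAll x (y ∷ ys) = (x ∷ y ∷ ys) ∷ map (y ∷_) (insertAll x ys)

-- all orderings of a list; for a duplicate-free list of length m these
-- correspond exactly to bijections {1,…,m} → (elements of the list),
-- via p(i) = i-th entry of the ordering.
perms : {A : Set} → List A → List (List A)
perms [] = [] ∷ []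
perms (x ∷ xs) = concatMap (insertAll x) (perms xs)

vsum : List (ℕ × ℕ) → List Λ → Λ
vsum ps ms = foldr _+Λ_ 0Λ (zipWith (λ p m → V (proj₁ p) m) ps ms)

-- |T^μ_{σ,λ}|, with μ listed as (μ₁,…,μ_m) = elems μ
Tcount : Λ → Λ → Multiset → ℕ
Tcount s a M = length (filter (λ ps → vsum ps (elems M) ≟Λ s) (perms (slots a)))

-- Right-hand side of the formula, paired with F ⊗ G:
-- ⟨ ∏_{μ∈μ} A_μ ⊗ A_λ , F ⊗ G ⟩ = (∏_{μ∈μ} f_μ) · g_λ.

validIndex : Λ → Multiset → Bool
validIndex a M =
  not (isZeroΛ a) ∧ (length (elems M) ≡ᵇ ∣ a ∣Λ)
    ∧ foldr (λ m r → not (isZeroΛ m) ∧ r) true (elems M)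

rhsTerm : PowerSeries → PowerSeries → Λ → (Λ × Multiset) → ℚ
rhsTerm f g s (a , M) =
  if validIndex a M
  then ((+ (aut s ℕ.* Tcount s a M) / (aut a ℕ.* autMS M)) {{m*n≢0 _ _ {{aut-nz a}} {{autMS-nz M}}}}
         *ℚ productℚ (map f (elems M))) *ℚ g a
  else 0ℚ

-- In G ⊛ F = Σ_λ g_λ/aut(λ) ∏_k F_k^{λ_k}, the product ∏_k F_k^{λ_k} has one factor F_k for each
-- slot (k , j) of λ, and the coefficient of x^σ in it is obtained by choosing a monomial x^{V^k μ}
-- of every factor so that the chosen exponents add up to σ. Grouped by the multiset μ of the
-- chosen μ's, each choice corresponds to |rep(μ)| bijections in T^μ_{σ,λ}, which produces the
-- factor 1/|rep(μ)|, while the coefficients f_μ/aut(μ) of F assemble into ∏ f_μ/∏ aut(μ).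
-- The identity is proved by induction on the list of slots: peeling off one factor F_k matches
-- removing one element from the multiset, and T^μ satisfies the same recursion. All sums are
-- finite because everything that can occur below σ has weight Σ_k k λ_k at most that of σ.

module Submission where

open import Defs
open import Algebra.Bundles using (CommutativeMonoid)
import Algebra.Properties.CommutativeSemigroup as CommSemigroupProperties
open import Data.Bool using (Bool; true; false; T; not; if_then_else_; _∧_)
open import Data.Bool.Properties using (T-∧)
open import Data.Empty using (⊥-elim)
open import Data.Product using (Σ; _×_; _,_; proj₁; proj₂)
open import Data.Sum using (_⊎_; inj₁; inj₂)
open import Data.Unit using (tt)
open import Data.Nat as ℕ using (ℕ; zero; suc; _+_; _*_; _∸_; _≤_; _<_; z≤n; s≤s; NonZero; _!; _^_)
import Data.Nat.Properties as ℕₚ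
import Data.Integer as ℤ
import Data.Integer.Properties as ℤₚ
open import Data.Rational using (ℚ; 0ℚ; 1ℚ; _/_) renaming (_+_ to _+ℚ_; _*_ to _*ℚ_)
import Data.Rational.Properties as ℚₚ
open import Data.Rational using (toℚᵘ)
open import Data.Rational.Unnormalised using (mkℚᵘ; *≡*) renaming (_≃_ to _≃ᵘ_)
import Data.Rational.Unnormalised.Properties as ℚᵘₚ
open import Data.Rational.Solver using (module +-*-Solver)
open import Data.List using (List; []; _∷_; map; _++_; concatMap; length; zipWith; upTo; applyUpTo; replicate; filter; deduplicate)
open import Data.Nat.ListAction using (sum; product)
import Data.Nat.ListAction.Properties as ListActionₚ
import Data.List.Properties as Listₚ
import Data.List.Relation.Unary.All.Properties as Allₚ
open import Data.List.Relation.Unary.All as All using (All; []; _∷_)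
open import Data.List.Relation.Unary.Any using (Any; here; there)
import Data.List.Relation.Unary.AllPairs as AllPairs
open import Data.List.Relation.Unary.Unique.Propositional using (Unique)
import Data.List.Relation.Unary.Unique.Propositional.Properties as Uniqueₚ
open import Data.List.Membership.Propositional using (_∈_)
open import Data.List.Membership.Propositional.Properties
  using (∈-∃++; ∈-map⁺; ∈-map⁻; ∈-concatMap⁺; ∈-concatMap⁻; ∈-upTo⁺; ∈-upTo⁻; ∈-filter⁻)
open import Data.List.Relation.Binary.Permutation.Propositional as ↭ using (_↭_; ↭⇒↭ₛ)
import Data.List.Relation.Binary.Permutation.Propositional.Properties as ↭ₚ
import Data.List.Relation.Binary.Permutation.Setoid.Properties as ↭ₛₚ
open import Function using (_∘_; Equivalence)
open import Relation.Nullary using (¬_; ¬?; Dec; yes; no; does)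
open import Relation.Nullary.Decidable using (recompute; T?)
open import Relation.Binary.Definitions using (tri<; tri≈; tri>)
open import Relation.Binary.PropositionalEquality

private
  module ℚ+ = CommSemigroupProperties (CommutativeMonoid.commutativeSemigroup ℚₚ.+-0-commutativeMonoid)
  module ℚ* = CommSemigroupProperties (CommutativeMonoid.commutativeSemigroup ℚₚ.*-1-commutativeMonoid)

-- Finite sums of rational families

∑ : {X : Set} → List X → (X → ℚ) → ℚ
∑ L t = sumℚ (map t L)

module _ {X : Set} where

  ∑-++ : (A B : List X) (t : X → ℚ) → ∑ (A ++ B) t ≡ ∑ A t +ℚ ∑ B t
  ∑-++ [] B t = sym (ℚₚ.+-identityˡ _)
  ∑-++ (x ∷ A) B t = trans (cong (t x +ℚ_) (∑-++ A B t)) (sym (ℚₚ.+-assoc (t x) _ _))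

  ∑-cong : (L : List X) {t u : X → ℚ} → (∀ {x} → x ∈ L → t x ≡ u x) → ∑ L t ≡ ∑ L u
  ∑-cong [] h = refl
  ∑-cong (x ∷ L) h = cong₂ _+ℚ_ (h (here refl)) (∑-cong L (h ∘ there))

  ∑-zero : (L : List X) {t : X → ℚ} → (∀ {x} → x ∈ L → t x ≡ 0ℚ) → ∑ L t ≡ 0ℚ
  ∑-zero [] h = refl
  ∑-zero (x ∷ L) h = cong₂ _+ℚ_ (h (here refl)) (∑-zero L (h ∘ there))

  ∑-+ : (L : List X) (t u : X → ℚ) → ∑ L (λ x → t x +ℚ u x) ≡ ∑ L t +ℚ ∑ L u
  ∑-+ [] t u = refl
  ∑-+ (x ∷ L) t u = trans (cong ((t x +ℚ u x) +ℚ_) (∑-+ L t u)) (ℚ+.interchange (t x) (u x) _ _)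

  ∑-*ˡ : (L : List X) (c : ℚ) (t : X → ℚ) → ∑ L (λ x → c *ℚ t x) ≡ c *ℚ ∑ L t
  ∑-*ˡ [] c t = sym (ℚₚ.*-zeroʳ c)
  ∑-*ˡ (x ∷ L) c t = trans (cong (c *ℚ t x +ℚ_) (∑-*ˡ L c t)) (sym (ℚₚ.*-distribˡ-+ c (t x) (∑ L t)))

  ∑-*ʳ : (L : List X) (c : ℚ) (t : X → ℚ) → ∑ L (λ x → t x *ℚ c) ≡ ∑ L t *ℚ c
  ∑-*ʳ L c t = trans (∑-cong L (λ {x} _ → ℚₚ.*-comm (t x) c)) (trans (∑-*ˡ L c t) (ℚₚ.*-comm c _))

  ∑-↭ : {L L′ : List X} (t : X → ℚ) → L ↭ L′ → ∑ L t ≡ ∑ L′ t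
  ∑-↭ t p = ↭ₛₚ.foldr-commMonoid (setoid ℚ) ℚₚ.+-0-isCommutativeMonoid (↭⇒↭ₛ (↭ₚ.map⁺ t p))

  ∑-nonzero : (L : List X) (t : X → ℚ) → ∑ L t ≢ 0ℚ → Σ X λ x → x ∈ L × t x ≢ 0ℚ
  ∑-nonzero [] t ne = ⊥-elim (ne refl)
  ∑-nonzero (x ∷ L) t ne with t x ℚₚ.≟ 0ℚ
  ... | no tx≢0 = x , here refl , tx≢0
  ... | yes tx≡0 with ∑-nonzero L t (λ e → ne (cong₂ _+ℚ_ tx≡0 e))
  ...   | y , y∈L , ty≢0 = y , there y∈L , ty≢0

module _ {X Y : Set} where

  ∑-map : (L : List X) (h : X → Y) (t : Y → ℚ) → ∑ (map h L) t ≡ ∑ L (t ∘ h)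
  ∑-map L h t = cong sumℚ (sym (Listₚ.map-∘ L))

  ∑-concatMap : (L : List X) (g : X → List Y) (t : Y → ℚ) → ∑ (concatMap g L) t ≡ ∑ L (λ x → ∑ (g x) t)
  ∑-concatMap [] g t = refl
  ∑-concatMap (x ∷ L) g t = trans (∑-++ (g x) (concatMap g L) t) (cong (∑ (g x) t +ℚ_) (∑-concatMap L g t))

  ∑-comm : (L₁ : List X) (L₂ : List Y) (F : X → Y → ℚ) →
    ∑ L₁ (λ x → ∑ L₂ (F x)) ≡ ∑ L₂ (λ y → ∑ L₁ (λ x → F x y))
  ∑-comm [] L₂ F = sym (∑-zero L₂ (λ _ → refl))
  ∑-comm (x ∷ L₁) L₂ F = trans (cong (∑ L₂ (F x) +ℚ_) (∑-comm L₁ L₂ F)) (sym (∑-+ L₂ (F x) _))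

module _ {X : Set} where

  private
    Unique-shift : (x : X) (A B : List X) → Unique (A ++ x ∷ B) → Unique (x ∷ A ++ B)
    Unique-shift x A B = ↭ₛₚ.Unique-resp-↭ (setoid X) (↭⇒↭ₛ (↭ₚ.shift x A B))

  ∑-support : (t : X → ℚ) {L₁ L₂ : List X} → Unique L₁ → Unique L₂ →
    (∀ {y} → t y ≢ 0ℚ → y ∈ L₁ → y ∈ L₂) → (∀ {y} → t y ≢ 0ℚ → y ∈ L₂ → y ∈ L₁) →
    ∑ L₁ t ≡ ∑ L₂ t
  ∑-support t {[]} {L₂} _ _ _ h₂₁ = sym (∑-zero L₂ vanish)
    where
    vanish : ∀ {y} → y ∈ L₂ → t y ≡ 0ℚ
    vanish {y} y∈L₂ with t y ℚₚ.≟ 0ℚ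
    ... | yes ty≡0 = ty≡0
    ... | no ty≢0 with () ← h₂₁ ty≢0 y∈L₂
  ∑-support t {x ∷ L₁} {L₂} u₁ u₂ h₁₂ h₂₁ with t x ℚₚ.≟ 0ℚ
  ... | yes tx≡0 = begin
    t x +ℚ ∑ L₁ t  ≡⟨ cong (_+ℚ ∑ L₁ t) tx≡0 ⟩
    0ℚ +ℚ ∑ L₁ t   ≡⟨ ℚₚ.+-identityˡ _ ⟩
    ∑ L₁ t         ≡⟨ ∑-support t (AllPairs.tail u₁) u₂ (λ ne → h₁₂ ne ∘ there) (λ ne → drop ne ∘ h₂₁ ne) ⟩
    ∑ L₂ t         ∎
    where
    open ≡-Reasoning
    drop : ∀ {y} → t y ≢ 0ℚ → y ∈ x ∷ L₁ → y ∈ L₁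
    drop ne (here refl) = ⊥-elim (ne tx≡0)
    drop ne (there y∈L₁) = y∈L₁
  ... | no tx≢0 with ∈-∃++ (h₁₂ tx≢0 (here refl))
  ... | A , B , refl = begin
    t x +ℚ ∑ L₁ t        ≡⟨ cong (t x +ℚ_) (∑-support t (AllPairs.tail u₁) (AllPairs.tail u′) to from) ⟩
    ∑ (x ∷ A ++ B) t     ≡⟨ ∑-↭ t (↭.↭-sym (↭ₚ.shift x A B)) ⟩
    ∑ (A ++ x ∷ B) t     ∎
    where
    open ≡-Reasoning
    u′ = Unique-shift x A B u₂
    to : ∀ {y} → t y ≢ 0ℚ → y ∈ L₁ → y ∈ A ++ B
    to ne y∈L₁ with ↭ₚ.∈-resp-↭ (↭ₚ.shift x A B) (h₁₂ ne (there y∈L₁))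
    ... | here refl = ⊥-elim (Uniqueₚ.Unique[x∷xs]⇒x∉xs u₁ y∈L₁)
    ... | there y∈AB = y∈AB
    from : ∀ {y} → t y ≢ 0ℚ → y ∈ A ++ B → y ∈ L₁
    from ne y∈AB with h₂₁ ne (↭ₚ.∈-resp-↭ (↭.↭-sym (↭ₚ.shift x A B)) (there y∈AB))
    ... | here refl = ⊥-elim (Uniqueₚ.Unique[x∷xs]⇒x∉xs u′ y∈AB)
    ... | there y∈L₁ = y∈L₁

  ∑-singleton-support : (t : X → ℚ) {L : List X} {v : X} → Unique L → v ∈ L →
    (∀ {y} → t y ≢ 0ℚ → y ≡ v) → ∑ L t ≡ t v
  ∑-singleton-support t u v∈L h =
    trans (∑-support t u ([] AllPairs.∷ AllPairs.[]) (λ ne _ → here (h ne)) (λ { _ (here refl) → v∈L }))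
          (ℚₚ.+-identityʳ _)

module _ {A B : Set} where

  Unique-map-on : (f : A → B) {L : List A} → Unique L →
    (∀ {x y} → x ∈ L → y ∈ L → f x ≡ f y → x ≡ y) → Unique (map f L)
  Unique-map-on f {[]} u inj = AllPairs.[]
  Unique-map-on f {x ∷ L} (x∉ AllPairs.∷ u) inj =
    Allₚ.map⁺ (All.tabulate λ y∈L fx≡fy → All.lookup x∉ y∈L (inj (here refl) (there y∈L) fx≡fy))
      AllPairs.∷ Unique-map-on f u (λ x∈ y∈ → inj (there x∈) (there y∈))

  Unique-concatMap : (g : A → List B) (tag : B → A) {L : List A} → Unique L →
    (∀ x → Unique (g x)) → (∀ {x b} → b ∈ g x → tag b ≡ x) → Unique (concatMap g L)
  Unique-concatMap g tag {[]} u ug ht = AllPairs.[]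
  Unique-concatMap g tag {x ∷ L} u ug ht =
    Uniqueₚ.++⁺ (ug x) (Unique-concatMap g tag (AllPairs.tail u) ug ht) disjoint
    where
    tagged : ∀ {b} {L′} → Any (λ z → b ∈ g z) L′ → tag b ∈ L′
    tagged (here b∈) = here (ht b∈)
    tagged (there b∈) = there (tagged b∈)
    disjoint : ∀ {b} → ¬ (b ∈ g x × b ∈ concatMap g L)
    disjoint (b∈gx , b∈rest) =
      Uniqueₚ.Unique[x∷xs]⇒x∉xs u (subst (_∈ L) (ht b∈gx) (tagged (∈-concatMap⁻ g b∈rest)))

  ∑-reindex : (φ : A → B) (F : B → ℚ) {L₁ : List A} {L₂ : List B} → Unique L₁ → Unique L₂ →
    (∀ {x y} → x ∈ L₁ → y ∈ L₁ → φ x ≡ φ y → x ≡ y) →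
    (∀ {x} → F (φ x) ≢ 0ℚ → x ∈ L₁ → φ x ∈ L₂) →
    (∀ {y} → F y ≢ 0ℚ → y ∈ L₂ → Σ A λ x → x ∈ L₁ × φ x ≡ y) →
    ∑ L₁ (F ∘ φ) ≡ ∑ L₂ F
  ∑-reindex φ F {L₁} u₁ u₂ inj into onto =
    trans (sym (∑-map L₁ φ F)) (∑-support F (Unique-map-on φ u₁ inj) u₂ to from)
    where
    to : ∀ {y} → F y ≢ 0ℚ → y ∈ map φ L₁ → y ∈ _
    to ne y∈ with x , x∈ , refl ← ∈-map⁻ φ y∈ = into ne x∈
    from : ∀ {y} → F y ≢ 0ℚ → y ∈ _ → y ∈ map φ L₁
    from ne y∈ with x , x∈ , refl ← onto ne y∈ = ∈-map⁺ φ x∈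

module _ {A B : Set} where

  dependentPairs : List A → (A → List B) → List (A × B)
  dependentPairs L g = concatMap (λ a → map (a ,_) (g a)) L

  ∑-dependentPairs : (L : List A) (g : A → List B) (F : A → B → ℚ) →
    ∑ (dependentPairs L g) (λ p → F (proj₁ p) (proj₂ p)) ≡ ∑ L (λ a → ∑ (g a) (F a))
  ∑-dependentPairs L g F = trans (∑-concatMap L _ _) (∑-cong L (λ {a} _ → ∑-map (g a) (a ,_) _))

  Unique-dependentPairs : {L : List A} (g : A → List B) → Unique L → (∀ a → Unique (g a)) →
    Unique (dependentPairs L g)
  Unique-dependentPairs g u ug = Unique-concatMap _ proj₁ u
    (λ a → Uniqueₚ.map⁺ (λ e → cong proj₂ e) (ug a)) tag
    where
    tag : ∀ {a p} → p ∈ map (a ,_) (g a) → proj₁ p ≡ a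
    tag p∈ with _ , _ , refl ← ∈-map⁻ _ p∈ = refl

  ∈-dependentPairs⁺ : {L : List A} (g : A → List B) {a : A} {b : B} → a ∈ L → b ∈ g a →
    (a , b) ∈ dependentPairs L g
  ∈-dependentPairs⁺ g {a} {b} a∈L b∈ga = ∈-concatMap⁺ _ (go a∈L)
    where
    go : ∀ {L′} → a ∈ L′ → Any (λ z → (a , b) ∈ map (z ,_) (g z)) L′
    go (here refl) = here (∈-map⁺ (a ,_) b∈ga)
    go (there a∈) = there (go a∈)

  ∈-dependentPairs⁻ : (L : List A) (g : A → List B) {a : A} {b : B} →
    (a , b) ∈ dependentPairs L g → a ∈ L × b ∈ g a
  ∈-dependentPairs⁻ L g ab∈ = go (∈-concatMap⁻ _ ab∈)
    where
    go : ∀ {a b L′} → Any (λ z → (a , b) ∈ map (z ,_) (g z)) L′ → a ∈ L′ × b ∈ g a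
    go (here ab∈) with _ , b∈ , refl ← ∈-map⁻ _ ab∈ = here refl , b∈
    go (there ab∈) = Data.Product.map₁ there (go ab∈)

-- Coordinates, order and difference on Λ

-- coord a i is the entry λ_{i+1}.
coord : Λ → ℕ → ℕ
coord a = at (entries a)

private
  normal-tail : ∀ x xs → T (normalB (x ∷ xs)) → T (normalB xs)
  normal-tail x [] _ = tt
  normal-tail x (y ∷ ys) p = p

  normal-at-zero : ∀ xs → T (normalB xs) → (∀ i → at xs i ≡ 0) → xs ≡ []
  normal-at-zero [] _ _ = refl
  normal-at-zero (zero ∷ []) () _
  normal-at-zero (suc x ∷ []) _ h with () ← h 0
  normal-at-zero (x ∷ y ∷ ys) p h with () ← normal-at-zero (y ∷ ys) p (h ∘ suc)

  normal-ext : ∀ xs ys → T (normalB xs) → T (normalB ys) → (∀ i → at xs i ≡ at ys i) → xs ≡ ys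
  normal-ext [] ys _ q h = sym (normal-at-zero ys q (sym ∘ h))
  normal-ext (x ∷ xs) [] p _ h = normal-at-zero (x ∷ xs) p h
  normal-ext (x ∷ xs) (y ∷ ys) p q h =
    cong₂ _∷_ (h 0) (normal-ext xs ys (normal-tail x xs p) (normal-tail y ys q) (h ∘ suc))

Λ-≡ : {a b : Λ} → entries a ≡ entries b → a ≡ b
Λ-≡ {mkΛ xs _} {mkΛ .xs _} refl = refl

Λ-ext : {a b : Λ} → (∀ i → coord a i ≡ coord b i) → a ≡ b
Λ-ext {mkΛ xs p} {mkΛ ys q} h =
  Λ-≡ (normal-ext xs ys (recompute (T? _) p) (recompute (T? _) q) h)

at-beyond : ∀ xs {i} → length xs ≤ i → at xs i ≡ 0
at-beyond [] _ = refl
at-beyond (x ∷ xs) (s≤s le) = at-beyond xs le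

coord-toΛ : ∀ xs i → coord (toΛ xs) i ≡ at xs i
coord-toΛ [] i = refl
coord-toΛ (x ∷ xs) i = trans (at-consS x (strip xs) i) (at-∷ i)
  where
  at-consS : ∀ x ys i → at (consS x ys) i ≡ at (x ∷ ys) i
  at-consS zero [] zero = refl
  at-consS zero [] (suc i) = refl
  at-consS (suc x) [] i = refl
  at-consS zero (y ∷ ys) i = refl
  at-consS (suc x) (y ∷ ys) i = refl
  at-∷ : ∀ i → at (x ∷ strip xs) i ≡ at (x ∷ xs) i
  at-∷ zero = refl
  at-∷ (suc i) = coord-toΛ xs i

coord-+ : ∀ a b i → coord (a +Λ b) i ≡ coord a i + coord b i
coord-+ a b i = trans (coord-toΛ (zipAdd (entries a) (entries b)) i) (at-zipAdd (entries a) (entries b) i)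
  where
  at-zipAdd : ∀ xs ys i → at (zipAdd xs ys) i ≡ at xs i + at ys i
  at-zipAdd [] ys i = refl
  at-zipAdd (x ∷ xs) [] i = sym (ℕₚ.+-identityʳ _)
  at-zipAdd (x ∷ xs) (y ∷ ys) zero = refl
  at-zipAdd (x ∷ xs) (y ∷ ys) (suc i) = at-zipAdd xs ys i

+Λ-comm : ∀ a b → a +Λ b ≡ b +Λ a
+Λ-comm a b = Λ-ext λ i → trans (coord-+ a b i) (trans (ℕₚ.+-comm (coord a i) _) (sym (coord-+ b a i)))

+Λ-assoc : ∀ a b c → (a +Λ b) +Λ c ≡ a +Λ (b +Λ c)
+Λ-assoc a b c = Λ-ext λ i → begin
  coord ((a +Λ b) +Λ c) i            ≡⟨ coord-+ (a +Λ b) c i ⟩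
  coord (a +Λ b) i + coord c i       ≡⟨ cong (_+ coord c i) (coord-+ a b i) ⟩
  coord a i + coord b i + coord c i  ≡⟨ ℕₚ.+-assoc (coord a i) _ _ ⟩
  coord a i + (coord b i + coord c i) ≡⟨ cong (coord a i +_) (coord-+ b c i) ⟨
  coord a i + coord (b +Λ c) i       ≡⟨ coord-+ a (b +Λ c) i ⟨
  coord (a +Λ (b +Λ c)) i            ∎
  where open ≡-Reasoning

infix 4 _≤Λ_ _≤Λ?_
infixl 6 _∸Λ_

_≤Λ_ : Λ → Λ → Set
a ≤Λ b = ∀ i → coord a i ≤ coord b i

_≤Λ?_ : ∀ a b → Dec (a ≤Λ b)
a ≤Λ? b = go (entries a) (entries b)
  where
  go : ∀ xs ys → Dec (∀ i → at xs i ≤ at ys i)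
  go [] ys = yes (λ _ → z≤n)
  go (x ∷ xs) [] with x ℕ.≟ 0 | go xs []
  ... | yes refl | yes rest = yes λ { zero → z≤n ; (suc i) → rest i }
  ... | no x≢0 | _ = no λ h → x≢0 (ℕₚ.n≤0⇒n≡0 (h 0))
  ... | yes _ | no ¬rest = no λ h → ¬rest (h ∘ suc)
  go (x ∷ xs) (y ∷ ys) with x ℕ.≤? y | go xs ys
  ... | yes x≤y | yes rest = yes λ { zero → x≤y ; (suc i) → rest i }
  ... | no x≰y | _ = no λ h → x≰y (h 0)
  ... | yes _ | no ¬rest = no λ h → ¬rest (h ∘ suc)

≤Λ-trans : ∀ {a b c} → a ≤Λ b → b ≤Λ c → a ≤Λ c
≤Λ-trans p q i = ℕₚ.≤-trans (p i) (q i)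

≤Λ-+ʳ : ∀ a b → a ≤Λ a +Λ b
≤Λ-+ʳ a b i = subst (coord a i ≤_) (sym (coord-+ a b i)) (ℕₚ.m≤m+n _ _)

private
  zipSub : List ℕ → List ℕ → List ℕ
  zipSub xs [] = xs
  zipSub [] (y ∷ ys) = []
  zipSub (x ∷ xs) (y ∷ ys) = (x ∸ y) ∷ zipSub xs ys

  at-zipSub : ∀ xs ys i → at (zipSub xs ys) i ≡ at xs i ∸ at ys i
  at-zipSub xs [] i = refl
  at-zipSub [] (y ∷ ys) zero = sym (ℕₚ.0∸n≡0 y)
  at-zipSub [] (y ∷ ys) (suc i) = sym (ℕₚ.0∸n≡0 (at ys i))
  at-zipSub (x ∷ xs) (y ∷ ys) zero = refl
  at-zipSub (x ∷ xs) (y ∷ ys) (suc i) = at-zipSub xs ys i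

_∸Λ_ : Λ → Λ → Λ
a ∸Λ b = toΛ (zipSub (entries a) (entries b))

coord-∸ : ∀ a b i → coord (a ∸Λ b) i ≡ coord a i ∸ coord b i
coord-∸ a b i = trans (coord-toΛ (zipSub (entries a) (entries b)) i) (at-zipSub (entries a) (entries b) i)

+-∸Λ : ∀ a b → (a +Λ b) ∸Λ a ≡ b
+-∸Λ a b = Λ-ext λ i →
  trans (coord-∸ (a +Λ b) a i) (trans (cong (_∸ coord a i) (coord-+ a b i)) (ℕₚ.m+n∸m≡n (coord a i) _))

∸Λ-+ : ∀ a b → b ≤Λ a → b +Λ (a ∸Λ b) ≡ a
∸Λ-+ a b b≤a = Λ-ext λ i →
  trans (coord-+ b (a ∸Λ b) i) (trans (cong (coord b i +_) (coord-∸ a b i)) (ℕₚ.m+[n∸m]≡n (b≤a i)))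

∸Λ-≤ : ∀ a b → a ∸Λ b ≤Λ a
∸Λ-≤ a b i = subst (_≤ coord a i) (sym (coord-∸ a b i)) (ℕₚ.m∸n≤m (coord a i) (coord b i))

∸Λ-∸Λ : ∀ a b c → c ≤Λ b → (a ∸Λ c) ∸Λ (b ∸Λ c) ≡ a ∸Λ b
∸Λ-∸Λ a b c c≤b = Λ-ext λ i → begin
  coord ((a ∸Λ c) ∸Λ (b ∸Λ c)) i               ≡⟨ coord-∸ (a ∸Λ c) (b ∸Λ c) i ⟩
  coord (a ∸Λ c) i ∸ coord (b ∸Λ c) i          ≡⟨ cong₂ _∸_ (coord-∸ a c i) (coord-∸ b c i) ⟩
  coord a i ∸ coord c i ∸ (coord b i ∸ coord c i) ≡⟨ ℕₚ.∸-+-assoc (coord a i) (coord c i) _ ⟩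
  coord a i ∸ (coord c i + (coord b i ∸ coord c i)) ≡⟨ cong (coord a i ∸_) (ℕₚ.m+[n∸m]≡n (c≤b i)) ⟩
  coord a i ∸ coord b i                        ≡⟨ coord-∸ a b i ⟨
  coord (a ∸Λ b) i                             ∎
  where open ≡-Reasoning

-- Power series multiplication

private
  box-sound : ∀ xs {ys} → ys ∈ box xs → length ys ≡ length xs × (∀ i → at ys i ≤ at xs i)
  box-sound [] (here refl) = refl , λ _ → z≤n
  box-sound (x ∷ xs) ys∈ = go (∈-concatMap⁻ _ {xs = upTo (suc x)} ys∈) ∈-upTo⁻
    where
    go : ∀ {L ys} → Any (λ y → ys ∈ map (y ∷_) (box xs)) L → (∀ {y} → y ∈ L → y < suc x) →
         length ys ≡ suc (length xs) × (∀ i → at ys i ≤ at (x ∷ xs) i)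
    go (there ys∈) bound = go ys∈ (bound ∘ there)
    go (here ys∈) bound with zs , zs∈ , refl ← ∈-map⁻ _ ys∈ with len , pw ← box-sound xs zs∈ =
      cong suc len , λ { zero → ℕₚ.≤-pred (bound (here refl)) ; (suc i) → pw i }

  box-complete : ∀ xs ys → length ys ≡ length xs → (∀ i → at ys i ≤ at xs i) → ys ∈ box xs
  box-complete [] [] _ _ = here refl
  box-complete (x ∷ xs) (y ∷ ys) len pw = ∈-concatMap⁺ _ (go (∈-upTo⁺ (s≤s (pw 0))))
    where
    go : ∀ {L} → y ∈ L → Any (λ z → (y ∷ ys) ∈ map (z ∷_) (box xs)) L
    go (here refl) = here (∈-map⁺ (y ∷_) (box-complete xs ys (ℕₚ.suc-injective len) (pw ∘ suc)))
    go (there y∈) = there (go y∈)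

  Unique-box : ∀ xs → Unique (box xs)
  Unique-box [] = [] AllPairs.∷ AllPairs.[]
  Unique-box (x ∷ xs) = Unique-concatMap _ head (Uniqueₚ.upTo⁺ (suc x))
    (λ y → Uniqueₚ.map⁺ Listₚ.∷-injectiveʳ (Unique-box xs)) tag
    where
    head : List ℕ → ℕ
    head [] = 0
    head (y ∷ _) = y
    tag : ∀ {y ys} → ys ∈ map (y ∷_) (box xs) → head ys ≡ y
    tag ys∈ with _ , _ , refl ← ∈-map⁻ _ ys∈ = refl

  list-ext : ∀ xs ys → length xs ≡ length ys → (∀ i → at xs i ≡ at ys i) → xs ≡ ys
  list-ext [] [] _ _ = refl
  list-ext (x ∷ xs) (y ∷ ys) len h = cong₂ _∷_ (h 0) (list-ext xs ys (ℕₚ.suc-injective len) (h ∘ suc))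

  padTo : ℕ → List ℕ → List ℕ
  padTo zero xs = []
  padTo (suc n) [] = 0 ∷ padTo n []
  padTo (suc n) (x ∷ xs) = x ∷ padTo n xs

  length-padTo : ∀ n xs → length (padTo n xs) ≡ n
  length-padTo zero xs = refl
  length-padTo (suc n) [] = cong suc (length-padTo n [])
  length-padTo (suc n) (x ∷ xs) = cong suc (length-padTo n xs)

  at-padTo : ∀ n xs {i} → i < n → at (padTo n xs) i ≡ at xs i
  at-padTo (suc n) [] {zero} _ = refl
  at-padTo (suc n) [] {suc i} (s≤s lt) = at-padTo n [] lt
  at-padTo (suc n) (x ∷ xs) {zero} _ = refl
  at-padTo (suc n) (x ∷ xs) {suc i} (s≤s lt) = at-padTo n xs lt

below : Λ → List Λ
below s = map toΛ (box (entries s))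

Unique-below : ∀ s → Unique (below s)
Unique-below s = Unique-map-on toΛ (Unique-box (entries s)) injective
  where
  injective : ∀ {xs ys} → xs ∈ box (entries s) → ys ∈ box (entries s) → toΛ xs ≡ toΛ ys → xs ≡ ys
  injective {xs} {ys} xs∈ ys∈ e =
    list-ext xs ys (trans (proj₁ (box-sound (entries s) xs∈)) (sym (proj₁ (box-sound (entries s) ys∈))))
      (λ i → trans (sym (coord-toΛ xs i)) (trans (cong (λ z → coord z i) e) (coord-toΛ ys i)))

∈-below⁻ : ∀ s {b} → b ∈ below s → b ≤Λ s
∈-below⁻ s b∈ with ys , ys∈ , refl ← ∈-map⁻ toΛ b∈ =
  λ i → subst (_≤ coord s i) (sym (coord-toΛ ys i)) (proj₂ (box-sound (entries s) ys∈) i)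

∈-below⁺ : ∀ s {b} → b ≤Λ s → b ∈ below s
∈-below⁺ s {b} b≤s = subst (_∈ below s) toΛ-ys≡b
  (∈-map⁺ toΛ (box-complete (entries s) ys (length-padTo n (entries b)) (λ i → subst (_≤ coord s i) (sym (at-ys i)) (b≤s i))))
  where
  n = length (entries s)
  ys = padTo n (entries b)
  at-ys : ∀ i → at ys i ≡ coord b i
  at-ys i with i ℕ.<? n
  ... | yes i<n = at-padTo n (entries b) i<n
  ... | no i≮n = trans (at-beyond ys (subst (_≤ i) (sym (length-padTo n (entries b))) (ℕₚ.≮⇒≥ i≮n)))
    (sym (ℕₚ.n≤0⇒n≡0 (subst (coord b i ≤_) (at-beyond (entries s) (ℕₚ.≮⇒≥ i≮n)) (b≤s i))))
  toΛ-ys≡b : toΛ ys ≡ b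
  toΛ-ys≡b = Λ-ext λ i → trans (coord-toΛ ys i) (at-ys i)

⋆-below : ∀ (A B : Ser) s → (A ⋆ B) s ≡ ∑ (below s) (λ b → A b *ℚ B (s ∸Λ b))
⋆-below A B s = sym (trans (∑-map (box (entries s)) toΛ _) (∑-cong (box (entries s)) same-difference))
  where
  at-zipWith∸ : ∀ xs ys i → length xs ≡ length ys → at (zipWith _∸_ xs ys) i ≡ at xs i ∸ at ys i
  at-zipWith∸ [] [] i _ = refl
  at-zipWith∸ (x ∷ xs) (y ∷ ys) zero _ = refl
  at-zipWith∸ (x ∷ xs) (y ∷ ys) (suc i) len = at-zipWith∸ xs ys i (ℕₚ.suc-injective len)
  same-difference : ∀ {α} → α ∈ box (entries s) →
    A (toΛ α) *ℚ B (s ∸Λ toΛ α) ≡ A (toΛ α) *ℚ B (toΛ (zipWith _∸_ (entries s) α))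
  same-difference {α} α∈ = cong (λ z → A (toΛ α) *ℚ B z) (Λ-ext λ i → begin
    coord (s ∸Λ toΛ α) i                    ≡⟨ coord-∸ s (toΛ α) i ⟩
    coord s i ∸ coord (toΛ α) i             ≡⟨ cong (coord s i ∸_) (coord-toΛ α i) ⟩
    coord s i ∸ at α i                      ≡⟨ at-zipWith∸ (entries s) α i (sym (proj₁ (box-sound (entries s) α∈))) ⟨
    at (zipWith _∸_ (entries s) α) i        ≡⟨ coord-toΛ (zipWith _∸_ (entries s) α) i ⟨
    coord (toΛ (zipWith _∸_ (entries s) α)) i ∎)
    where open ≡-Reasoning

⋆-cong : ∀ {A A′ B B′ : Ser} → A ≗ A′ → B ≗ B′ → A ⋆ B ≗ A′ ⋆ B′
⋆-cong {A} {A′} {B} {B′} A≗A′ B≗B′ s =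
  trans (⋆-below A B s)
    (trans (∑-cong (below s) (λ {b} _ → cong₂ _*ℚ_ (A≗A′ b) (B≗B′ (s ∸Λ b)))) (sym (⋆-below A′ B′ s)))

⋆-congˡ : ∀ A {B B′ : Ser} → B ≗ B′ → A ⋆ B ≗ A ⋆ B′
⋆-congˡ A = ⋆-cong {A} {A} (λ _ → refl)

⋆-identityˡ : ∀ C → oneSer ⋆ C ≗ C
⋆-identityˡ C s = begin
  (oneSer ⋆ C) s                                  ≡⟨ ⋆-below oneSer C s ⟩
  ∑ (below s) (λ b → oneSer b *ℚ C (s ∸Λ b))      ≡⟨ ∑-singleton-support _ (Unique-below s) (∈-below⁺ s (λ _ → z≤n)) at-zero ⟩
  1ℚ *ℚ C (s ∸Λ 0Λ)                               ≡⟨ ℚₚ.*-identityˡ _ ⟩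
  C (s ∸Λ 0Λ)                                     ≡⟨ cong C (Λ-ext (coord-∸ s 0Λ)) ⟩
  C s                                             ∎
  where
  open ≡-Reasoning
  at-zero : ∀ {b} → oneSer b *ℚ C (s ∸Λ b) ≢ 0ℚ → b ≡ 0Λ
  at-zero {b} ne with b ≟Λ 0Λ
  ... | yes b≡0 = b≡0
  ... | no _ = ⊥-elim (ne (ℚₚ.*-zeroˡ (C (s ∸Λ b))))

-- A chain b ≤ a ≤ s is the same as a splitting of s into b, c = a ∸ b and the rest.
∑-chains : ∀ s (F : Λ × Λ → ℚ) →
  ∑ (dependentPairs (below s) below) (λ p → F (proj₂ p , proj₁ p ∸Λ proj₂ p)) ≡ ∑ (dependentPairs (below s) (λ b → below (s ∸Λ b))) F
∑-chains s F = ∑-reindex φ F (Unique-dependentPairs below (Unique-below s) Unique-below)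
  (Unique-dependentPairs (λ b → below (s ∸Λ b)) (Unique-below s) (Unique-below ∘ (s ∸Λ_)))
  φ-injective (λ _ → φ-into) (λ _ → φ-onto)
  where
  open ≡-Reasoning
  chains = dependentPairs (below s) below
  splits = dependentPairs (below s) (λ b → below (s ∸Λ b))
  φ : Λ × Λ → Λ × Λ
  φ (a , b) = b , a ∸Λ b
  chain : ∀ {a b} → (a , b) ∈ chains → b ≤Λ a × a ≤Λ s
  chain {a} ab∈ with a∈ , b∈ ← ∈-dependentPairs⁻ (below s) below ab∈ = ∈-below⁻ a b∈ , ∈-below⁻ s a∈
  φ-injective : ∀ {p q} → p ∈ chains → q ∈ chains → φ p ≡ φ q → p ≡ q
  φ-injective {a , b} {a′ , b′} p∈ q∈ e with refl ← cong proj₁ e = cong (_, b) (begin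
    a                  ≡⟨ ∸Λ-+ a b (proj₁ (chain p∈)) ⟨
    b +Λ (a ∸Λ b)      ≡⟨ cong (b +Λ_) (cong proj₂ e) ⟩
    b +Λ (a′ ∸Λ b)     ≡⟨ ∸Λ-+ a′ b (proj₁ (chain q∈)) ⟩
    a′                 ∎)
  φ-into : ∀ {p} → p ∈ chains → φ p ∈ splits
  φ-into {a , b} ab∈ with b≤a , a≤s ← chain ab∈ =
    ∈-dependentPairs⁺ (λ b → below (s ∸Λ b)) (∈-below⁺ s (≤Λ-trans {b} {a} {s} b≤a a≤s))
      (∈-below⁺ (s ∸Λ b) λ i → subst₂ _≤_ (sym (coord-∸ a b i)) (sym (coord-∸ s b i)) (ℕₚ.∸-monoˡ-≤ (coord b i) (a≤s i)))
  φ-onto : ∀ {q} → q ∈ splits → Σ (Λ × Λ) λ p → p ∈ chains × φ p ≡ q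
  φ-onto {b , c} bc∈ with b∈ , c∈ ← ∈-dependentPairs⁻ (below s) (λ b → below (s ∸Λ b)) bc∈ =
    (b +Λ c , b) , ∈-dependentPairs⁺ below (∈-below⁺ s b+c≤s) (∈-below⁺ (b +Λ c) (≤Λ-+ʳ b c)) , cong (b ,_) (+-∸Λ b c)
    where
    b≤s = ∈-below⁻ s b∈
    c≤s∸b = ∈-below⁻ (s ∸Λ b) c∈
    b+c≤s : b +Λ c ≤Λ s
    b+c≤s i = subst (_≤ coord s i) (sym (coord-+ b c i))
      (subst (coord b i + coord c i ≤_) (ℕₚ.m+[n∸m]≡n (b≤s i))
        (ℕₚ.+-monoʳ-≤ (coord b i) (subst (coord c i ≤_) (coord-∸ s b i) (c≤s∸b i))))

⋆-assoc : ∀ A B C → (A ⋆ B) ⋆ C ≗ A ⋆ (B ⋆ C)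
⋆-assoc A B C s = begin
  ((A ⋆ B) ⋆ C) s
    ≡⟨ ⋆-below (A ⋆ B) C s ⟩
  ∑ (below s) (λ a → (A ⋆ B) a *ℚ C (s ∸Λ a))
    ≡⟨ ∑-cong (below s) (λ {a} _ → trans (cong (_*ℚ C (s ∸Λ a)) (⋆-below A B a)) (sym (∑-*ʳ (below a) _ _))) ⟩
  ∑ (below s) (λ a → ∑ (below a) (λ b → (A b *ℚ B (a ∸Λ b)) *ℚ C (s ∸Λ a)))
    ≡⟨ ∑-dependentPairs (below s) below _ ⟨
  ∑ (dependentPairs (below s) below) (λ p → (A (proj₂ p) *ℚ B (proj₁ p ∸Λ proj₂ p)) *ℚ C (s ∸Λ proj₁ p))
    ≡⟨ ∑-cong (dependentPairs (below s) below) (λ { {a , b} → reassociate }) ⟩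
  ∑ (dependentPairs (below s) below) (λ p → F (proj₂ p , proj₁ p ∸Λ proj₂ p))
    ≡⟨ ∑-chains s F ⟩
  ∑ (dependentPairs (below s) (λ b → below (s ∸Λ b))) F
    ≡⟨ ∑-dependentPairs (below s) (λ b → below (s ∸Λ b)) _ ⟩
  ∑ (below s) (λ b → ∑ (below (s ∸Λ b)) (λ c → A b *ℚ (B c *ℚ C ((s ∸Λ b) ∸Λ c))))
    ≡⟨ ∑-cong (below s) (λ {b} _ → trans (∑-*ˡ (below (s ∸Λ b)) (A b) _) (cong (A b *ℚ_) (sym (⋆-below B C (s ∸Λ b))))) ⟩
  ∑ (below s) (λ b → A b *ℚ (B ⋆ C) (s ∸Λ b))
    ≡⟨ ⋆-below A (B ⋆ C) s ⟨
  (A ⋆ (B ⋆ C)) s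
    ∎
  where
  open ≡-Reasoning
  F : Λ × Λ → ℚ
  F (b , c) = A b *ℚ (B c *ℚ C ((s ∸Λ b) ∸Λ c))
  reassociate : ∀ {a b} → (a , b) ∈ dependentPairs (below s) below →
    (A b *ℚ B (a ∸Λ b)) *ℚ C (s ∸Λ a) ≡ F (b , a ∸Λ b)
  reassociate {a} {b} ab∈ with a∈ , b∈ ← ∈-dependentPairs⁻ (below s) below ab∈ =
    trans (ℚₚ.*-assoc (A b) _ _) (cong (λ z → A b *ℚ (B (a ∸Λ b) *ℚ C z)) (sym (∸Λ-∸Λ s a b (∈-below⁻ a b∈))))

-- The Verschiebung operators and the weight

private
  Vlist : ℕ → List ℕ → List ℕ
  Vlist k = concatMap (λ x → replicate k 0 ++ x ∷ [])

  at-block : ∀ k x R i → at ((replicate k 0 ++ x ∷ []) ++ R) (k + i) ≡ at (x ∷ R) i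
  at-block zero x R i = refl
  at-block (suc k) x R i = at-block k x R i

  at-Vlist : ∀ k xs j → at (Vlist k xs) (k + suc k * j) ≡ at xs j
  at-Vlist k [] j = refl
  at-Vlist k (x ∷ xs) zero =
    trans (cong (λ z → at (Vlist k (x ∷ xs)) (k + z)) (ℕₚ.*-zeroʳ k)) (at-block k x (Vlist k xs) 0)
  at-Vlist k (x ∷ xs) (suc j) =
    trans (cong (λ z → at (Vlist k (x ∷ xs)) (k + z)) (ℕₚ.*-suc (suc k) j))
      (trans (at-block k x (Vlist k xs) (suc (k + suc k * j))) (at-Vlist k xs j))

  at-applyUpTo : ∀ (g : ℕ → ℕ) {n j} → j < n → at (applyUpTo g n) j ≡ g j
  at-applyUpTo g {suc n} {zero} _ = refl
  at-applyUpTo g {suc n} {suc j} (s≤s lt) = at-applyUpTo (g ∘ suc) lt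

-- The entry (V^{k+1} a)_{(k+1)(j+1)} = a_{j+1}, in zero-based coordinates.
coord-V : ∀ k a j → coord (V (suc k) a) (k + suc k * j) ≡ coord a j
coord-V k a j = trans (coord-toΛ (Vlist k (entries a)) _) (at-Vlist k (entries a) j)

coord-contract : ∀ k s j → coord (contract (suc k) s) j ≡ coord s (k + suc k * j)
coord-contract k s j with j ℕ.<? length (entries s)
... | yes j<L = begin
  coord (contract (suc k) s) j               ≡⟨ coord-toΛ (map g (map suc (upTo L))) j ⟩
  at (map g (map suc (upTo L))) j            ≡⟨ cong (λ z → at z j) C≡ ⟩
  at (applyUpTo (g ∘ suc) L) j               ≡⟨ at-applyUpTo _ j<L ⟩
  coord s (suc k * suc j ∸ 1)                ≡⟨ cong (λ z → coord s (z ∸ 1)) (ℕₚ.*-suc (suc k) j) ⟩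
  coord s (k + suc k * j)                    ∎
  where
  open ≡-Reasoning
  L = length (entries s)
  g : ℕ → ℕ
  g i = at (entries s) (suc k * i ∸ 1)
  C≡ : map g (map suc (upTo L)) ≡ applyUpTo (g ∘ suc) L
  C≡ = trans (cong (map g) (Listₚ.map-applyUpTo (λ i → i) suc L)) (Listₚ.map-applyUpTo suc g L)
... | no j≮L = trans (coord-toΛ C j) (trans (at-beyond C L≤j′) (sym (at-beyond (entries s) L≤index)))
  where
  L = length (entries s)
  L≤j = ℕₚ.≮⇒≥ j≮L
  g : ℕ → ℕ
  g i = at (entries s) (suc k * i ∸ 1)
  C = map g (map suc (upTo L))
  L≤j′ : length C ≤ j
  L≤j′ = subst (_≤ j) (sym (trans (Listₚ.length-map g (map suc (upTo L))) (trans (Listₚ.length-map suc (upTo L)) (Listₚ.length-upTo L)))) L≤j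
  L≤index : L ≤ k + suc k * j
  L≤index = ℕₚ.≤-trans L≤j (ℕₚ.≤-trans (ℕₚ.m≤n*m j (suc k)) (ℕₚ.m≤n+m _ k))

contract-V : ∀ k a → contract (suc k) (V (suc k) a) ≡ a
contract-V k a = Λ-ext λ j → trans (coord-contract k (V (suc k) a) j) (coord-V k a j)

V-injective : ∀ k {a b} → V (suc k) a ≡ V (suc k) b → a ≡ b
V-injective k {a} {b} e = trans (sym (contract-V k a)) (trans (cong (contract (suc k)) e) (contract-V k b))

dilate-V : ∀ k p a → dilate (suc k) p (V (suc k) a) ≡ p a
dilate-V k p a with V (suc k) (contract (suc k) (V (suc k) a)) ≟Λ V (suc k) a
... | yes _ = cong p (contract-V k a)
... | no ne = ⊥-elim (ne (cong (V (suc k)) (contract-V k a)))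

dilate-nonzero : ∀ k p b → dilate k p b ≢ 0ℚ → V k (contract k b) ≡ b × dilate k p b ≡ p (contract k b)
dilate-nonzero k p b ne with V k (contract k b) ≟Λ b
... | yes e = e , refl
... | no _ = ⊥-elim (ne refl)

private
  weightFrom : ℕ → List ℕ → ℕ
  weightFrom c [] = 0
  weightFrom c (x ∷ xs) = c * x + weightFrom (suc c) xs

  weightFrom-strip : ∀ c xs → weightFrom c (strip xs) ≡ weightFrom c xs
  weightFrom-strip c [] = refl
  weightFrom-strip c (x ∷ xs) = trans (consS-weight x (strip xs)) (cong (c * x +_) (weightFrom-strip (suc c) xs))
    where
    consS-weight : ∀ x ys → weightFrom c (consS x ys) ≡ weightFrom c (x ∷ ys)
    consS-weight zero [] = sym (cong (_+ 0) (ℕₚ.*-zeroʳ c))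
    consS-weight (suc x) [] = refl
    consS-weight zero (y ∷ ys) = refl
    consS-weight (suc x) (y ∷ ys) = refl

  weightFrom-zipAdd : ∀ c xs ys → weightFrom c (zipAdd xs ys) ≡ weightFrom c xs + weightFrom c ys
  weightFrom-zipAdd c [] ys = refl
  weightFrom-zipAdd c (x ∷ xs) [] = sym (ℕₚ.+-identityʳ _)
  weightFrom-zipAdd c (x ∷ xs) (y ∷ ys) =
    trans (cong₂ _+_ (ℕₚ.*-distribˡ-+ c x y) (weightFrom-zipAdd (suc c) xs ys))
      (ℕ+.interchange (c * x) (c * y) _ _)
    where module ℕ+ = CommSemigroupProperties ℕₚ.+-commutativeSemigroup

  weightFrom-at : ∀ c xs i → at xs i * (c + i) ≤ weightFrom c xs
  weightFrom-at c [] i = z≤n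
  weightFrom-at c (x ∷ xs) zero =
    subst (_≤ c * x + weightFrom (suc c) xs) (trans (ℕₚ.*-comm c x) (cong (x *_) (sym (ℕₚ.+-identityʳ c)))) (ℕₚ.m≤m+n _ _)
  weightFrom-at c (x ∷ xs) (suc i) =
    subst (λ z → at xs i * z ≤ c * x + weightFrom (suc c) xs) (sym (ℕₚ.+-suc c i))
      (ℕₚ.≤-trans (weightFrom-at (suc c) xs i) (ℕₚ.m≤n+m _ _))

  weightFrom-zeros : ∀ c k R → weightFrom c (replicate k 0 ++ R) ≡ weightFrom (c + k) R
  weightFrom-zeros c zero R = cong (λ z → weightFrom z R) (sym (ℕₚ.+-identityʳ c))
  weightFrom-zeros c (suc k) R =
    trans (cong (_+ weightFrom (suc c) (replicate k 0 ++ R)) (ℕₚ.*-zeroʳ c))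
      (trans (weightFrom-zeros (suc c) k R) (cong (λ z → weightFrom z R) (sym (ℕₚ.+-suc c k))))

  weightFrom-Vlist : ∀ k t xs → weightFrom (suc (suc k * t)) (Vlist k xs) ≡ suc k * weightFrom (suc t) xs
  weightFrom-Vlist k t [] = sym (ℕₚ.*-zeroʳ (suc k))
  weightFrom-Vlist k t (x ∷ xs) = begin
    weightFrom c₀ ((replicate k 0 ++ x ∷ []) ++ Vlist k xs)
      ≡⟨ cong (weightFrom c₀) (Listₚ.++-assoc (replicate k 0) (x ∷ []) (Vlist k xs)) ⟩
    weightFrom c₀ (replicate k 0 ++ x ∷ Vlist k xs)
      ≡⟨ weightFrom-zeros c₀ k (x ∷ Vlist k xs) ⟩
    (c₀ + k) * x + weightFrom (suc (c₀ + k)) (Vlist k xs)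
      ≡⟨ cong (λ c → c * x + weightFrom (suc c) (Vlist k xs)) c₀+k≡ ⟩
    (suc k * suc t) * x + weightFrom (suc (suc k * suc t)) (Vlist k xs)
      ≡⟨ cong₂ _+_ (ℕₚ.*-assoc (suc k) (suc t) x) (weightFrom-Vlist k (suc t) xs) ⟩
    suc k * (suc t * x) + suc k * weightFrom (suc (suc t)) xs
      ≡⟨ ℕₚ.*-distribˡ-+ (suc k) (suc t * x) _ ⟨
    suc k * weightFrom (suc t) (x ∷ xs)
      ∎
    where
    open ≡-Reasoning
    c₀ = suc (suc k * t)
    c₀+k≡ : c₀ + k ≡ suc k * suc t
    c₀+k≡ = trans (cong suc (ℕₚ.+-comm (suc k * t) k)) (sym (ℕₚ.*-suc (suc k) t))

-- Σ_k k · λ_k, the degree of x^λ when x_k has degree k.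
weight : Λ → ℕ
weight a = weightFrom 1 (entries a)

weight-+ : ∀ a b → weight (a +Λ b) ≡ weight a + weight b
weight-+ a b = trans (weightFrom-strip 1 (zipAdd (entries a) (entries b))) (weightFrom-zipAdd 1 (entries a) (entries b))

weight-V : ∀ k a → weight (V (suc k) a) ≡ suc k * weight a
weight-V k a = trans (weightFrom-strip 1 (Vlist k (entries a)))
  (subst (λ c → weightFrom (suc c) (Vlist k (entries a)) ≡ suc k * weight a) (ℕₚ.*-zeroʳ (suc k)) (weightFrom-Vlist k 0 (entries a)))

weight-mono : ∀ a b → a ≤Λ b → weight a ≤ weight b
weight-mono a b a≤b =
  subst (weight a ≤_) (trans (sym (weight-+ a (b ∸Λ a))) (cong weight (∸Λ-+ b a a≤b))) (ℕₚ.m≤m+n (weight a) _)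

coord*index≤weight : ∀ a i → coord a i * suc i ≤ weight a
coord*index≤weight a = weightFrom-at 1 (entries a)

coord≤weight : ∀ a i → coord a i ≤ weight a
coord≤weight a i = ℕₚ.≤-trans (ℕₚ.m≤m*n (coord a i) (suc i)) (coord*index≤weight a i)

weight-pos : ∀ a → a ≢ 0Λ → 1 ≤ weight a
weight-pos a a≢0 with weight a in e
... | zero = ⊥-elim (a≢0 (Λ-ext λ i → ℕₚ.n≤0⇒n≡0 (subst (coord a i ≤_) e (coord≤weight a i))))
... | suc _ = s≤s z≤n

∑slots≡weight : ∀ a → sum (map proj₁ (slots a)) ≡ weight a
∑slots≡weight a = go 1 (entries a)
  where
  constant : ∀ k (h : ℕ → ℕ) n → sum (map (λ _ → k) (applyUpTo h n)) ≡ n * k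
  constant k h zero = refl
  constant k h (suc n) = cong (k +_) (constant k (h ∘ suc) n)
  go : ∀ k as → sum (map proj₁ (slotsFrom k as)) ≡ weightFrom k as
  go k [] = refl
  go k (a ∷ as) = begin
    sum (map proj₁ (map (λ j → (k , suc j)) (upTo a) ++ slotsFrom (suc k) as))
      ≡⟨ cong sum (Listₚ.map-++ proj₁ (map (λ j → (k , suc j)) (upTo a)) (slotsFrom (suc k) as)) ⟩
    sum (map proj₁ (map (λ j → (k , suc j)) (upTo a)) ++ map proj₁ (slotsFrom (suc k) as))
      ≡⟨ ListActionₚ.sum-++ (map proj₁ (map (λ j → (k , suc j)) (upTo a))) _ ⟩
    sum (map proj₁ (map (λ j → (k , suc j)) (upTo a))) + sum (map proj₁ (slotsFrom (suc k) as))
      ≡⟨ cong₂ _+_ (trans (cong sum (sym (Listₚ.map-∘ (upTo a)))) (trans (constant k (λ i → i) a) (ℕₚ.*-comm a k)))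
                   (go (suc k) as) ⟩
    k * a + weightFrom (suc k) as
      ∎
    where open ≡-Reasoning

-- Products of dilated series, slot by slot

ifBelow : Λ → Λ → ℚ → ℚ
ifBelow b τ q = if does (b ≤Λ? τ) then q else 0ℚ

ifBelow-yes : ∀ b τ q → b ≤Λ τ → ifBelow b τ q ≡ q
ifBelow-yes b τ q b≤τ with b ≤Λ? τ
... | yes _ = refl
... | no b≰τ = ⊥-elim (b≰τ b≤τ)

ifBelow-nonzero : ∀ b τ q → ifBelow b τ q ≢ 0ℚ → b ≤Λ τ
ifBelow-nonzero b τ q ne with b ≤Λ? τ
... | yes b≤τ = b≤τ
... | no _ = ⊥-elim (ne refl)

ifBelow-zero : ∀ b τ → ifBelow b τ 0ℚ ≡ 0ℚ
ifBelow-zero b τ with b ≤Λ? τ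
... | yes _ = refl
... | no _ = refl

ifBelow-cong : ∀ b τ {q q′} → (b ≤Λ τ → q ≡ q′) → ifBelow b τ q ≡ ifBelow b τ q′
ifBelow-cong b τ h with b ≤Λ? τ
... | yes b≤τ = h b≤τ
... | no _ = refl

ifBelow-*ˡ : ∀ b τ c q → ifBelow b τ (c *ℚ q) ≡ c *ℚ ifBelow b τ q
ifBelow-*ˡ b τ c q with b ≤Λ? τ
... | yes _ = refl
... | no _ = sym (ℚₚ.*-zeroʳ c)

ifBelow-*ʳ : ∀ b τ q c → ifBelow b τ q *ℚ c ≡ ifBelow b τ (q *ℚ c)
ifBelow-*ʳ b τ q c with b ≤Λ? τ
... | yes _ = refl
... | no _ = ℚₚ.*-zeroˡ c

ifBelow-∑ : ∀ {X : Set} b τ (L : List X) (f : X → ℚ) → ∑ L (λ x → ifBelow b τ (f x)) ≡ ifBelow b τ (∑ L f)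
ifBelow-∑ b τ L f with b ≤Λ? τ
... | yes _ = refl
... | no _ = ∑-zero L (λ _ → refl)

dilate-⋆ : ∀ k p X τ {D} → Unique D → (∀ {u} → V (suc k) u ≤Λ τ → p u ≢ 0ℚ → u ∈ D) →
  (dilate (suc k) p ⋆ X) τ ≡ ∑ D (λ u → p u *ℚ ifBelow (V (suc k) u) τ (X (τ ∸Λ V (suc k) u)))
dilate-⋆ k p X τ {D} uD D-complete = begin
  (dilate (suc k) p ⋆ X) τ
    ≡⟨ ⋆-below (dilate (suc k) p) X τ ⟩
  ∑ (below τ) (λ b → dilate (suc k) p b *ℚ X (τ ∸Λ b))
    ≡⟨ ∑-cong (below τ) (λ {b} b∈ → sym (ifBelow-yes b τ _ (∈-below⁻ τ b∈))) ⟩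
  ∑ (below τ) F
    ≡⟨ ∑-reindex Vₖ F uD (Unique-below τ) (λ _ _ → V-injective k) into onto ⟨
  ∑ D (F ∘ Vₖ)
    ≡⟨ ∑-cong D (λ {u} _ → trans (cong (λ z → ifBelow (Vₖ u) τ (z *ℚ X (τ ∸Λ Vₖ u))) (dilate-V k p u))
                                 (ifBelow-*ˡ (Vₖ u) τ (p u) _)) ⟩
  ∑ D (λ u → p u *ℚ ifBelow (Vₖ u) τ (X (τ ∸Λ Vₖ u)))
    ∎
  where
  open ≡-Reasoning
  Vₖ = V (suc k)
  F : Λ → ℚ
  F b = ifBelow b τ (dilate (suc k) p b *ℚ X (τ ∸Λ b))
  into : ∀ {u} → F (Vₖ u) ≢ 0ℚ → u ∈ D → Vₖ u ∈ below τ
  into {u} ne _ = ∈-below⁺ τ (ifBelow-nonzero (Vₖ u) τ _ ne)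
  onto : ∀ {b} → F b ≢ 0ℚ → b ∈ below τ → Σ Λ λ u → u ∈ D × Vₖ u ≡ b
  onto {b} ne b∈ = u , D-complete (subst (_≤Λ τ) (sym Vu≡b) (∈-below⁻ τ b∈)) pu≢0 , Vu≡b
    where
    u = contract (suc k) b
    dilate≢0 : dilate (suc k) p b ≢ 0ℚ
    dilate≢0 e = ne (trans (ifBelow-yes b τ _ (∈-below⁻ τ b∈)) (trans (cong (_*ℚ X (τ ∸Λ b)) e) (ℚₚ.*-zeroˡ (X (τ ∸Λ b)))))
    Vu≡b = proj₁ (dilate-nonzero (suc k) p b dilate≢0)
    pu≢0 : p u ≢ 0ℚ
    pu≢0 e = dilate≢0 (trans (proj₂ (dilate-nonzero (suc k) p b dilate≢0)) e)

slotProduct : Ser → List (ℕ × ℕ) → Ser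
slotProduct p [] = oneSer
slotProduct p ((k , _) ∷ S) = dilate k p ⋆ slotProduct p S

slotProduct-block : ∀ p k (L : List ℕ) S →
  slotProduct p (map (λ j → (k , suc j)) L ++ S) ≗ powSer (dilate k p) (length L) ⋆ slotProduct p S
slotProduct-block p k [] S s = sym (⋆-identityˡ (slotProduct p S) s)
slotProduct-block p k (j ∷ L) S s =
  trans (⋆-congˡ (dilate k p) (slotProduct-block p k L S) s)
        (sym (⋆-assoc (dilate k p) (powSer (dilate k p) (length L)) (slotProduct p S) s))

prodDilates≗slotProduct : ∀ p k as → prodDilates p k as ≗ slotProduct p (slotsFrom k as)
prodDilates≗slotProduct p k [] s = refl
prodDilates≗slotProduct p k (a ∷ as) s = begin
  (powSer (dilate k p) a ⋆ prodDilates p (suc k) as) s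
    ≡⟨ ⋆-congˡ (powSer (dilate k p) a) (prodDilates≗slotProduct p (suc k) as) s ⟩
  (powSer (dilate k p) a ⋆ slotProduct p rest) s
    ≡⟨ cong (λ n → (powSer (dilate k p) n ⋆ slotProduct p rest) s) (Listₚ.length-upTo a) ⟨
  (powSer (dilate k p) (length (upTo a)) ⋆ slotProduct p rest) s
    ≡⟨ slotProduct-block p k (upTo a) rest s ⟨
  slotProduct p (slotsFrom k (a ∷ as)) s
    ∎
  where
  open ≡-Reasoning
  rest = slotsFrom (suc k) as

-- Counting the bijections in T^μ_{σ,λ}

δ : Λ → Λ → ℚ
δ a b = if does (a ≟Λ b) then 1ℚ else 0ℚ

δ-nonzero : ∀ a b → δ a b ≢ 0ℚ → a ≡ b
δ-nonzero a b ne with a ≟Λ b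
... | yes a≡b = a≡b
... | no _ = ⊥-elim (ne refl)

δ-+Λ : ∀ a X τ → δ (a +Λ X) τ ≡ ifBelow a τ (δ X (τ ∸Λ a))
δ-+Λ a X τ with a ≤Λ? τ
... | no a≰τ with (a +Λ X) ≟Λ τ
...   | yes refl = ⊥-elim (a≰τ (≤Λ-+ʳ a X))
...   | no _ = refl
δ-+Λ a X τ | yes a≤τ with (a +Λ X) ≟Λ τ | X ≟Λ (τ ∸Λ a)
... | yes _ | yes _ = refl
... | no _ | no _ = refl
... | yes refl | no ne = ⊥-elim (ne (sym (+-∸Λ a X)))
... | no ne | yes refl = ⊥-elim (ne (∸Λ-+ τ a a≤τ))

select : {A : Set} → List A → List (A × List A)
select [] = []
select (m ∷ ms) = (m , ms) ∷ map (λ { (v , r) → v , m ∷ r }) (select ms)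

∑select : {A : Set} → List A → (A → List A → ℚ) → ℚ
∑select M G = ∑ (select M) (λ { (v , r) → G v r })

module _ {A : Set} where

  ∑select-∷ : (x : A) (M : List A) (G : A → List A → ℚ) →
    ∑select (x ∷ M) G ≡ G x M +ℚ ∑select M (λ v r → G v (x ∷ r))
  ∑select-∷ x M G = cong (G x M +ℚ_) (∑-map (select M) _ _)

  length-select : (M : List A) {v : A} {r : List A} → (v , r) ∈ select M → suc (length r) ≡ length M
  length-select (m ∷ M) (here refl) = refl
  length-select (m ∷ M) (there vr∈) with _ , vr∈′ , refl ← ∈-map⁻ _ vr∈ = cong suc (length-select M vr∈′)

  select-↭ : (M : List A) {v : A} {r : List A} → (v , r) ∈ select M → M ↭ v ∷ r
  select-↭ (m ∷ M) (here refl) = ↭.refl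
  select-↭ (m ∷ M) (there vr∈) with (v , r) , vr∈′ , refl ← ∈-map⁻ _ vr∈ =
    ↭.trans (↭.prep m (select-↭ M vr∈′)) (↭.swap m v ↭.refl)

  map-proj₁-select : (M : List A) → map proj₁ (select M) ≡ M
  map-proj₁-select [] = refl
  map-proj₁-select (m ∷ M) = cong (m ∷_) (trans (sym (Listₚ.map-∘ (select M))) (map-proj₁-select M))

  ∑select-resp-↭ : {M M′ : List A} → M ↭ M′ → (G : A → List A → ℚ) →
    (∀ v {r r′} → r ↭ r′ → G v r ≡ G v r′) → ∑select M G ≡ ∑select M′ G
  ∑select-resp-↭ ↭.refl G G-resp = refl
  ∑select-resp-↭ {x ∷ M} {.x ∷ M′} (↭.prep x p) G G-resp = begin
    ∑select (x ∷ M) G                               ≡⟨ ∑select-∷ x M G ⟩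
    G x M +ℚ ∑select M (λ v r → G v (x ∷ r))        ≡⟨ cong₂ _+ℚ_ (G-resp x p) (∑select-resp-↭ p _ (λ v → G-resp v ∘ ↭.prep x)) ⟩
    G x M′ +ℚ ∑select M′ (λ v r → G v (x ∷ r))      ≡⟨ ∑select-∷ x M′ G ⟨
    ∑select (x ∷ M′) G                              ∎
    where open ≡-Reasoning
  ∑select-resp-↭ {x ∷ y ∷ M} {.y ∷ .x ∷ M′} (↭.swap x y p) G G-resp = begin
    ∑select (x ∷ y ∷ M) G
      ≡⟨ trans (∑select-∷ x (y ∷ M) G) (cong (G x (y ∷ M) +ℚ_) (∑select-∷ y M (λ v r → G v (x ∷ r)))) ⟩
    G x (y ∷ M) +ℚ (G y (x ∷ M) +ℚ ∑select M (λ v r → G v (x ∷ y ∷ r)))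
      ≡⟨ ℚ+.x∙yz≈y∙xz (G x (y ∷ M)) (G y (x ∷ M)) _ ⟩
    G y (x ∷ M) +ℚ (G x (y ∷ M) +ℚ ∑select M (λ v r → G v (x ∷ y ∷ r)))
      ≡⟨ cong₂ _+ℚ_ (G-resp y (↭.prep x p)) (cong₂ _+ℚ_ (G-resp x (↭.prep y p)) rest) ⟩
    G y (x ∷ M′) +ℚ (G x (y ∷ M′) +ℚ ∑select M′ (λ v r → G v (y ∷ x ∷ r)))
      ≡⟨ trans (∑select-∷ y (x ∷ M′) G) (cong (G y (x ∷ M′) +ℚ_) (∑select-∷ x M′ (λ v r → G v (y ∷ r)))) ⟨
    ∑select (y ∷ x ∷ M′) G
      ∎
    where
    open ≡-Reasoning
    rest : ∑select M (λ v r → G v (x ∷ y ∷ r)) ≡ ∑select M′ (λ v r → G v (y ∷ x ∷ r))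
    rest = trans (∑select-resp-↭ p _ (λ v → G-resp v ∘ ↭.prep x ∘ ↭.prep y))
                 (∑-cong (select M′) (λ _ → G-resp _ (↭.swap x y ↭.refl)))
  ∑select-resp-↭ (↭.trans p q) G G-resp = trans (∑select-resp-↭ p G G-resp) (∑select-resp-↭ q G G-resp)

module _ {A : Set} (x : A) where

  length-insertAll : (p : List A) {q : List A} → q ∈ insertAll x p → length q ≡ suc (length p)
  length-insertAll [] (here refl) = refl
  length-insertAll (y ∷ ys) (here refl) = refl
  length-insertAll (y ∷ ys) (there q∈) with _ , q∈′ , refl ← ∈-map⁻ _ q∈ = cong suc (length-insertAll ys q∈′)

length-perms : {A : Set} (S : List A) {q : List A} → q ∈ perms S → length q ≡ length S
length-perms [] (here refl) = refl
length-perms (x ∷ S) {q} q∈ = go (∈-concatMap⁻ (insertAll x) {xs = perms S} q∈) (λ p∈ → p∈)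
  where
  go : ∀ {L} → Any (λ p → q ∈ insertAll x p) L → (∀ {p} → p ∈ L → p ∈ perms S) → length q ≡ suc (length S)
  go (here q∈′) sub = trans (length-insertAll x _ q∈′) (cong suc (length-perms S (sub (here refl))))
  go (there q∈′) sub = go q∈′ (sub ∘ there)

-- Inserting the slot x at each position of p matches the entries of M with x in every possible way.
vsum-insertAll : ∀ x p M → length M ≡ suc (length p) →
  map (λ q → vsum q M) (insertAll x p) ≡ map (λ { (v , r) → V (proj₁ x) v +Λ vsum p r }) (select M)
vsum-insertAll x [] (m ∷ []) _ = refl
vsum-insertAll x (y ∷ ys) (m ∷ ms) len = cong (V (proj₁ x) m +Λ vsum (y ∷ ys) ms ∷_) (begin
  map (λ q → vsum q (m ∷ ms)) (map (y ∷_) (insertAll x ys))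
    ≡⟨ Listₚ.map-∘ (insertAll x ys) ⟨
  map (λ q → Vy +Λ vsum q ms) (insertAll x ys)
    ≡⟨ Listₚ.map-∘ (insertAll x ys) ⟩
  map (Vy +Λ_) (map (λ q → vsum q ms) (insertAll x ys))
    ≡⟨ cong (map (Vy +Λ_)) (vsum-insertAll x ys ms (ℕₚ.suc-injective len)) ⟩
  map (Vy +Λ_) (map (λ { (v , r) → V (proj₁ x) v +Λ vsum ys r }) (select ms))
    ≡⟨ Listₚ.map-∘ (select ms) ⟨
  map (λ { (v , r) → Vy +Λ (V (proj₁ x) v +Λ vsum ys r) }) (select ms)
    ≡⟨ Listₚ.map-cong (λ { (v , r) → swap-middle Vy (V (proj₁ x) v) (vsum ys r) }) (select ms) ⟩
  map (λ { (v , r) → V (proj₁ x) v +Λ vsum (y ∷ ys) (m ∷ r) }) (select ms)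
    ≡⟨ Listₚ.map-∘ (select ms) ⟩
  map (λ { (v , r) → V (proj₁ x) v +Λ vsum (y ∷ ys) r }) (map (λ { (v , r) → v , m ∷ r }) (select ms))
    ∎)
  where
  open ≡-Reasoning
  Vy = V (proj₁ y) m
  swap-middle : ∀ a b c → a +Λ (b +Λ c) ≡ b +Λ (a +Λ c)
  swap-middle a b c = trans (sym (+Λ-assoc a b c)) (trans (cong (_+Λ c) (+Λ-comm a b)) (+Λ-assoc b a c))

-- |T| for the slot list S and the list of entries M, as a rational.  It is
-- set to 0 unless |M| = |S|, since vsum silently truncates the longer list.
countT : List (ℕ × ℕ) → List Λ → Λ → ℚ
countT S M τ = if length M ℕ.≡ᵇ length S then ∑ (perms S) (λ ps → δ (vsum ps M) τ) else 0ℚ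

countT-matched : ∀ S M τ → length M ≡ length S → countT S M τ ≡ ∑ (perms S) (λ ps → δ (vsum ps M) τ)
countT-matched S M τ len with length M ℕ.≡ᵇ length S | ℕₚ.≡⇒≡ᵇ (length M) (length S) len
... | true | _ = refl

countT-shift : ∀ S r a τ → length r ≡ length S →
  ∑ (perms S) (λ ps → δ (a +Λ vsum ps r) τ) ≡ ifBelow a τ (countT S r (τ ∸Λ a))
countT-shift S r a τ len = begin
  ∑ (perms S) (λ ps → δ (a +Λ vsum ps r) τ)
    ≡⟨ ∑-cong (perms S) (λ {ps} _ → δ-+Λ a (vsum ps r) τ) ⟩
  ∑ (perms S) (λ ps → ifBelow a τ (δ (vsum ps r) (τ ∸Λ a)))
    ≡⟨ ifBelow-∑ a τ (perms S) _ ⟩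
  ifBelow a τ (∑ (perms S) (λ ps → δ (vsum ps r) (τ ∸Λ a)))
    ≡⟨ cong (ifBelow a τ) (countT-matched S r (τ ∸Λ a) len) ⟨
  ifBelow a τ (countT S r (τ ∸Λ a))
    ∎
  where open ≡-Reasoning

countT-∷ : ∀ x S M τ →
  countT (x ∷ S) M τ ≡ ∑select M (λ v r → ifBelow (V (proj₁ x) v) τ (countT S r (τ ∸Λ V (proj₁ x) v)))
countT-∷ x S M τ with length M ℕ.≡ᵇ suc (length S) in matched
... | false = sym (∑-zero (select M) (λ { {v , r} → vanish v r }))
  where
  vanish : ∀ v r → (v , r) ∈ select M → ifBelow (V (proj₁ x) v) τ (countT S r (τ ∸Λ V (proj₁ x) v)) ≡ 0ℚ
  vanish v r vr∈ with length r ℕ.≡ᵇ length S in matched′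
  ... | true = ⊥-elim (subst T matched (ℕₚ.≡⇒≡ᵇ (length M) (suc (length S))
                 (trans (sym (length-select M vr∈)) (cong suc (ℕₚ.≡ᵇ⇒≡ (length r) (length S) (subst T (sym matched′) tt))))))
  ... | false = ifBelow-zero (V (proj₁ x) v) τ
... | true = begin
  ∑ (concatMap (insertAll x) (perms S)) (λ ps → δ (vsum ps M) τ)
    ≡⟨ ∑-concatMap (perms S) (insertAll x) _ ⟩
  ∑ (perms S) (λ p → ∑ (insertAll x p) (λ ps → δ (vsum ps M) τ))
    ≡⟨ ∑-cong (perms S) insert≡select ⟩
  ∑ (perms S) (λ p → ∑select M (λ v r → δ (Vₓ v +Λ vsum p r) τ))
    ≡⟨ ∑-comm (perms S) (select M) _ ⟩
  ∑select M (λ v r → ∑ (perms S) (λ p → δ (Vₓ v +Λ vsum p r) τ))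
    ≡⟨ ∑-cong (select M) (λ { {v , r} vr∈ → countT-shift S r (Vₓ v) τ (ℕₚ.suc-injective (trans (length-select M vr∈) len)) }) ⟩
  ∑select M (λ v r → ifBelow (Vₓ v) τ (countT S r (τ ∸Λ Vₓ v)))
    ∎
  where
  open ≡-Reasoning
  Vₓ = V (proj₁ x)
  len : length M ≡ suc (length S)
  len = ℕₚ.≡ᵇ⇒≡ (length M) (suc (length S)) (subst T (sym matched) tt)
  insert≡select : ∀ {p} → p ∈ perms S →
    ∑ (insertAll x p) (λ ps → δ (vsum ps M) τ) ≡ ∑select M (λ v r → δ (Vₓ v +Λ vsum p r) τ)
  insert≡select {p} p∈ = trans (sym (∑-map (insertAll x p) (λ q → vsum q M) (λ z → δ z τ)))
    (trans (cong (λ L → ∑ L (λ z → δ z τ)) (vsum-insertAll x p M (trans len (cong suc (sym (length-perms S p∈))))))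
      (∑-map (select M) _ (λ z → δ z τ)))

countT-resp-↭ : ∀ S {M M′} τ → M ↭ M′ → countT S M τ ≡ countT S M′ τ
countT-resp-↭ [] τ p = cong (λ n → if n ℕ.≡ᵇ 0 then δ 0Λ τ +ℚ 0ℚ else 0ℚ) (↭ₚ.↭-length p)
countT-resp-↭ (x ∷ S) {M} {M′} τ p = begin
  countT (x ∷ S) M τ    ≡⟨ countT-∷ x S M τ ⟩
  ∑select M G           ≡⟨ ∑select-resp-↭ p G (λ v q → cong (ifBelow (V (proj₁ x) v) τ) (countT-resp-↭ S (τ ∸Λ V (proj₁ x) v) q)) ⟩
  ∑select M′ G          ≡⟨ countT-∷ x S M′ τ ⟨
  countT (x ∷ S) M′ τ   ∎
  where
  open ≡-Reasoning
  G : Λ → List Λ → ℚ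
  G v r = ifBelow (V (proj₁ x) v) τ (countT S r (τ ∸Λ V (proj₁ x) v))

-- Multisets as sorted lists

private
  leqL-< : ∀ {x y} (xs ys : List ℕ) → x < y → leqL (x ∷ xs) (y ∷ ys) ≡ true
  leqL-< {zero} {suc y} xs ys _ = refl
  leqL-< {suc x} {suc y} xs ys (s≤s x<y) = leqL-< {x} {y} xs ys x<y

  leqL-> : ∀ {x y} (xs ys : List ℕ) → y < x → leqL (x ∷ xs) (y ∷ ys) ≡ false
  leqL-> {suc x} {zero} xs ys _ = refl
  leqL-> {suc x} {suc y} xs ys (s≤s y<x) = leqL-> {x} {y} xs ys y<x

  leqL-≡ : ∀ x (xs ys : List ℕ) → leqL (x ∷ xs) (x ∷ ys) ≡ leqL xs ys
  leqL-≡ zero xs ys = refl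
  leqL-≡ (suc x) xs ys = leqL-≡ x xs ys

  T-true : ∀ {b} → b ≡ true → T b
  T-true refl = tt

  ¬T-false : ∀ {b} → b ≡ false → ¬ T b
  ¬T-false refl ()

leqL-refl : ∀ xs → T (leqL xs xs)
leqL-refl [] = tt
leqL-refl (x ∷ xs) = subst T (sym (leqL-≡ x xs xs)) (leqL-refl xs)

leqL-total : ∀ xs ys → T (leqL xs ys) ⊎ T (leqL ys xs)
leqL-total [] ys = inj₁ tt
leqL-total (x ∷ xs) [] = inj₂ tt
leqL-total (x ∷ xs) (y ∷ ys) with ℕₚ.<-cmp x y
... | tri< x<y _ _ = inj₁ (T-true (leqL-< xs ys x<y))
... | tri> _ _ y<x = inj₂ (T-true (leqL-< ys xs y<x))
... | tri≈ _ refl _ = Data.Sum.map (subst T (sym (leqL-≡ x xs ys))) (subst T (sym (leqL-≡ x ys xs))) (leqL-total xs ys)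

leqL-antisym : ∀ xs ys → T (leqL xs ys) → T (leqL ys xs) → xs ≡ ys
leqL-antisym [] [] _ _ = refl
leqL-antisym (x ∷ xs) (y ∷ ys) p q with ℕₚ.<-cmp x y
... | tri< x<y _ _ = ⊥-elim (¬T-false (leqL-> ys xs x<y) q)
... | tri> _ _ y<x = ⊥-elim (¬T-false (leqL-> xs ys y<x) p)
... | tri≈ _ refl _ = cong (x ∷_) (leqL-antisym xs ys (subst T (leqL-≡ x xs ys) p) (subst T (leqL-≡ x ys xs) q))

leqL-trans : ∀ xs ys zs → T (leqL xs ys) → T (leqL ys zs) → T (leqL xs zs)
leqL-trans [] ys zs _ _ = tt
leqL-trans (x ∷ xs) (y ∷ ys) (z ∷ zs) p q with ℕₚ.<-cmp x y | ℕₚ.<-cmp y z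
... | tri> _ _ y<x | _ = ⊥-elim (¬T-false (leqL-> xs ys y<x) p)
... | _ | tri> _ _ z<y = ⊥-elim (¬T-false (leqL-> ys zs z<y) q)
... | tri< x<y _ _ | tri< y<z _ _ = T-true (leqL-< xs zs (ℕₚ.<-trans x<y y<z))
... | tri< x<y _ _ | tri≈ _ refl _ = T-true (leqL-< xs zs x<y)
... | tri≈ _ refl _ | tri< y<z _ _ = T-true (leqL-< xs zs y<z)
... | tri≈ _ refl _ | tri≈ _ refl _ =
  subst T (sym (leqL-≡ x xs zs)) (leqL-trans xs ys zs (subst T (leqL-≡ x xs ys) p) (subst T (leqL-≡ x ys zs) q))

_≼_ : Λ → Λ → Set
a ≼ b = T (leqL (entries a) (entries b))

record Sorted (L : List Λ) : Set where
  constructor mkSorted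
  field isSorted : T (sortedB L)

Sorted-tail : ∀ {a L} → Sorted (a ∷ L) → Sorted L
Sorted-tail {a} {[]} _ = mkSorted tt
Sorted-tail {a} {b ∷ L} (mkSorted s) = mkSorted (proj₂ (Equivalence.to T-∧ s))

Sorted-head : ∀ {a L} → Sorted (a ∷ L) → All (a ≼_) L
Sorted-head {a} {[]} _ = []
Sorted-head {a} {b ∷ L} (mkSorted s) with a≼b , s′ ← Equivalence.to T-∧ s =
  a≼b ∷ All.map (λ {c} → leqL-trans (entries a) (entries b) (entries c) a≼b) (Sorted-head (mkSorted s′))

Sorted-∷ : ∀ {a L} → All (a ≼_) L → Sorted L → Sorted (a ∷ L)
Sorted-∷ {a} {[]} _ _ = mkSorted tt
Sorted-∷ {a} {b ∷ L} (a≼b ∷ _) (mkSorted s) = mkSorted (Equivalence.from T-∧ (a≼b , s))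

Sorted-↭-≡ : ∀ {L L′} → Sorted L → Sorted L′ → L ↭ L′ → L ≡ L′
Sorted-↭-≡ {[]} _ _ p = sym (↭ₚ.↭-empty-inv (↭.↭-sym p))
Sorted-↭-≡ {a ∷ A} {[]} _ _ p = ↭ₚ.↭-empty-inv p
Sorted-↭-≡ {a ∷ A} {b ∷ B} s s′ p =
  cong₂ _∷_ a≡b (Sorted-↭-≡ (Sorted-tail s) (Sorted-tail s′) (↭ₚ.drop-∷ (subst (λ z → a ∷ A ↭ z ∷ B) (sym a≡b) p)))
  where
  a≡b : a ≡ b
  a≡b with ↭ₚ.∈-resp-↭ p (here refl) | ↭ₚ.∈-resp-↭ (↭.↭-sym p) (here refl)
  ... | here e | _ = e
  ... | _ | here e = sym e
  ... | there a∈B | there b∈A =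
    Λ-≡ (leqL-antisym (entries a) (entries b) (All.lookup (Sorted-head s) b∈A) (All.lookup (Sorted-head s′) a∈B))

insert : Λ → List Λ → List Λ
insert u [] = u ∷ []
insert u (a ∷ as) = if leqL (entries u) (entries a) then u ∷ a ∷ as else a ∷ insert u as

insert-↭ : ∀ u L → insert u L ↭ u ∷ L
insert-↭ u [] = ↭.refl
insert-↭ u (a ∷ as) with leqL (entries u) (entries a)
... | true = ↭.refl
... | false = ↭.trans (↭.prep a (insert-↭ u as)) (↭.swap a u ↭.refl)

Sorted-insert : ∀ u {L} → Sorted L → Sorted (insert u L)
Sorted-insert u {[]} _ = mkSorted tt
Sorted-insert u {a ∷ as} s with leqL (entries u) (entries a) in u≼a
... | true = Sorted-∷ (T-true u≼a ∷ All.map (λ {c} → leqL-trans (entries u) (entries a) (entries c) (T-true u≼a)) (Sorted-head s)) s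
... | false = Sorted-∷ (↭ₚ.All-resp-↭ (↭.↭-sym (insert-↭ u as)) (a≼u ∷ Sorted-head s)) (Sorted-insert u (Sorted-tail s))
  where
  a≼u : a ≼ u
  a≼u with leqL-total (entries u) (entries a)
  ... | inj₁ u≼a′ = ⊥-elim (¬T-false u≼a u≼a′)
  ... | inj₂ a≼u = a≼u

remove : Λ → List Λ → List Λ
remove u [] = []
remove u (a ∷ as) = if does (u ≟Λ a) then as else a ∷ remove u as

remove-All : ∀ {P : Λ → Set} u {L} → All P L → All P (remove u L)
remove-All u {[]} [] = []
remove-All u {a ∷ as} (pa ∷ ps) with u ≟Λ a
... | yes _ = ps
... | no _ = pa ∷ remove-All u ps

Sorted-remove : ∀ u {L} → Sorted L → Sorted (remove u L)
Sorted-remove u {[]} _ = mkSorted tt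
Sorted-remove u {a ∷ as} s with u ≟Λ a
... | yes _ = Sorted-tail s
... | no _ = Sorted-∷ (remove-All u (Sorted-head s)) (Sorted-remove u (Sorted-tail s))

remove-↭ : ∀ {u L} → u ∈ L → L ↭ u ∷ remove u L
remove-↭ {u} {a ∷ as} u∈ with u ≟Λ a
... | yes refl = ↭.refl
remove-↭ (here u≡a) | no u≢a = ⊥-elim (u≢a u≡a)
remove-↭ {u} {a ∷ as} (there u∈) | no _ = ↭.trans (↭.prep a (remove-↭ u∈)) (↭.swap a u ↭.refl)

remove-insert : ∀ u L → remove u (insert u L) ≡ L
remove-insert u [] with u ≟Λ u
... | yes _ = refl
... | no u≢u = ⊥-elim (u≢u refl)
remove-insert u (a ∷ as) with leqL (entries u) (entries a) in u≼a
... | true with u ≟Λ u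
...   | yes _ = refl
...   | no u≢u = ⊥-elim (u≢u refl)
remove-insert u (a ∷ as) | false with u ≟Λ a
...   | yes refl = ⊥-elim (¬T-false u≼a (leqL-refl (entries u)))
...   | no _ = cong (a ∷_) (remove-insert u as)

insert-remove : ∀ {u L} → Sorted L → u ∈ L → insert u (remove u L) ≡ L
insert-remove {u} {L} s u∈ = Sorted-↭-≡ (Sorted-insert u (Sorted-remove u s)) s
  (↭.trans (insert-↭ u (remove u L)) (↭.↭-sym (remove-↭ u∈)))

count-resp-↭ : ∀ a {L L′} → L ↭ L′ → count a L ≡ count a L′
count-resp-↭ a ↭.refl = refl
count-resp-↭ a (↭.prep x p) with a ≟Λ x
... | yes _ = cong suc (count-resp-↭ a p)
... | no _ = count-resp-↭ a p
count-resp-↭ a (↭.swap x y p) with a ≟Λ x | a ≟Λ y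
... | yes _ | yes _ = cong (suc ∘ suc) (count-resp-↭ a p)
... | yes _ | no _ = cong suc (count-resp-↭ a p)
... | no _ | yes _ = cong suc (count-resp-↭ a p)
... | no _ | no _ = count-resp-↭ a p
count-resp-↭ a (↭.trans p q) = trans (count-resp-↭ a p) (count-resp-↭ a q)

count-∷-≡ : ∀ u L → count u (u ∷ L) ≡ suc (count u L)
count-∷-≡ u L with u ≟Λ u
... | yes _ = refl
... | no u≢u = ⊥-elim (u≢u refl)

count-∷-≢ : ∀ {u v} L → u ≢ v → count u (v ∷ L) ≡ count u L
count-∷-≢ {u} {v} L u≢v with u ≟Λ v
... | yes u≡v = ⊥-elim (u≢v u≡v)
... | no _ = refl

count-insert : ∀ u L → count u (insert u L) ≡ suc (count u L)
count-insert u L = trans (count-resp-↭ u (insert-↭ u L)) (count-∷-≡ u L)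

count≢0⇒∈ : ∀ u L → count u L ≢ 0 → u ∈ L
count≢0⇒∈ u [] ne = ⊥-elim (ne refl)
count≢0⇒∈ u (a ∷ L) ne with u ≟Λ a
... | yes u≡a = here u≡a
... | no _ = there (count≢0⇒∈ u L ne)

-- |rep(L)| = ∏_v (multiplicity of v)!, accumulated one position at a time.
repFactor : List Λ → ℕ
repFactor [] = 1
repFactor (v ∷ L) = suc (count v L) * repFactor L

repFactor-resp-↭ : ∀ {L L′} → L ↭ L′ → repFactor L ≡ repFactor L′
repFactor-resp-↭ ↭.refl = refl
repFactor-resp-↭ (↭.prep x p) = cong₂ _*_ (cong suc (count-resp-↭ x p)) (repFactor-resp-↭ p)
repFactor-resp-↭ {x ∷ y ∷ L} {.y ∷ .x ∷ L′} (↭.swap x y p) = begin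
  suc (count x (y ∷ L)) * (suc (count y L) * repFactor L)
    ≡⟨ ℕₚ.*-assoc (suc (count x (y ∷ L))) (suc (count y L)) (repFactor L) ⟨
  suc (count x (y ∷ L)) * suc (count y L) * repFactor L
    ≡⟨ cong₂ _*_ (swapped x y L) (repFactor-resp-↭ p) ⟩
  suc (count y (x ∷ L)) * suc (count x L) * repFactor L′
    ≡⟨ ℕₚ.*-assoc (suc (count y (x ∷ L))) (suc (count x L)) (repFactor L′) ⟩
  suc (count y (x ∷ L)) * (suc (count x L) * repFactor L′)
    ≡⟨ cong₂ (λ m n → suc m * (suc n * repFactor L′)) (count-resp-↭ y (↭.prep x p)) (count-resp-↭ x p) ⟩
  suc (count y (x ∷ L′)) * (suc (count x L′) * repFactor L′)
    ∎
  where
  open ≡-Reasoning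
  swapped : ∀ x y L → suc (count x (y ∷ L)) * suc (count y L) ≡ suc (count y (x ∷ L)) * suc (count x L)
  swapped x y L with x ≟Λ y | y ≟Λ x
  ... | yes refl | yes _ = refl
  ... | yes x≡y | no y≢x = ⊥-elim (y≢x (sym x≡y))
  ... | no x≢y | yes y≡x = ⊥-elim (x≢y (sym y≡x))
  ... | no _ | no _ = ℕₚ.*-comm (suc (count x L)) (suc (count y L))
repFactor-resp-↭ (↭.trans p q) = trans (repFactor-resp-↭ p) (repFactor-resp-↭ q)

repFactor-insert : ∀ u L → repFactor (insert u L) ≡ suc (count u L) * repFactor L
repFactor-insert u L = repFactor-resp-↭ (insert-↭ u L)

repFactor-nonZero : ∀ L → NonZero (repFactor L)
repFactor-nonZero [] = _
repFactor-nonZero (v ∷ L) = ℕₚ.m*n≢0 (suc (count v L)) (repFactor L) {{_}} {{repFactor-nonZero L}}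

private
  without : Λ → List Λ → List Λ
  without v = filter (λ y → ¬? (v ≟Λ y))

  product-split : ∀ (f : Λ → ℕ) v D → product (map f D) ≡ product (map f (without v D)) * f v ^ count v D
  product-split f v [] = refl
  product-split f v (x ∷ D) with v ≟Λ x
  ... | yes refl = trans (cong (f v *_) (product-split f v D)) (ℕ*.x∙yz≈y∙xz (f v) (product (map f (without v D))) _)
    where module ℕ* = CommSemigroupProperties ℕₚ.*-commutativeSemigroup
  ... | no _ = trans (cong (f x *_) (product-split f v D)) (sym (ℕₚ.*-assoc (f x) _ _))

  count-without-≡ : ∀ v D → count v (without v D) ≡ 0
  count-without-≡ v [] = refl
  count-without-≡ v (x ∷ D) with v ≟Λ x
  ... | yes _ = count-without-≡ v D
  ... | no v≢x = trans (count-∷-≢ (without v D) v≢x) (count-without-≡ v D)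

  count-without-≢ : ∀ {v x} D → v ≢ x → count v (without x D) ≡ count v D
  count-without-≢ [] _ = refl
  count-without-≢ {v} {x} (y ∷ D) v≢x with x ≟Λ y
  ... | yes refl = trans (count-without-≢ D v≢x) (sym (count-∷-≢ D v≢x))
  ... | no _ with v ≟Λ y
  ...   | yes _ = cong suc (count-without-≢ D v≢x)
  ...   | no _ = count-without-≢ D v≢x

  -- Either v occurs exactly once in the deduplicated list, or count v L = 0 and both sides are 1.
  factorial-power : ∀ v L → (count v L !) ^ count v (deduplicate _≟Λ_ L) ≡ count v L !
  factorial-power v [] = refl
  factorial-power v (x ∷ L) with v ≟Λ x
  ... | yes refl = trans (cong (λ z → (suc (count v L) !) ^ suc z) (count-without-≡ v (deduplicate _≟Λ_ L)))
                         (ℕₚ.*-identityʳ (suc (count v L) !))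
  ... | no v≢x = trans (cong ((count v L !) ^_) (count-without-≢ (deduplicate _≟Λ_ L) v≢x)) (factorial-power v L)

repSize≡repFactor : ∀ M → repSize M ≡ repFactor (elems M)
repSize≡repFactor M = go (elems M)
  where
  Π! : List Λ → List Λ → ℕ
  Π! L D = product (map (λ a → count a L !) D)
  go : ∀ L → Π! L (deduplicate _≟Λ_ L) ≡ repFactor L
  go [] = refl
  go (v ∷ L) = begin
    Π! (v ∷ L) (v ∷ rest)
      ≡⟨ cong₂ (λ c r → c ! * r) (count-∷-≡ v L) (others (without v (deduplicate _≟Λ_ L)) (λ a∈ → proj₂ (∈-filter⁻ (λ y → ¬? (v ≟Λ y)) {xs = deduplicate _≟Λ_ L} a∈))) ⟩
    (suc c !) * Π! L rest
      ≡⟨ ℕₚ.*-assoc (suc c) (c !) _ ⟩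
    suc c * (c ! * Π! L rest)
      ≡⟨ cong (λ z → suc c * z) (trans (ℕₚ.*-comm (c !) _) (cong (Π! L rest *_) (sym (factorial-power v L)))) ⟩
    suc c * (Π! L rest * (c !) ^ count v (deduplicate _≟Λ_ L))
      ≡⟨ cong (suc c *_) (sym (product-split (λ a → count a L !) v (deduplicate _≟Λ_ L))) ⟩
    suc c * Π! L (deduplicate _≟Λ_ L)
      ≡⟨ cong (suc c *_) (go L) ⟩
    suc c * repFactor L
      ∎
    where
    open ≡-Reasoning
    c = count v L
    rest = without v (deduplicate _≟Λ_ L)
    others : ∀ D → (∀ {a} → a ∈ D → v ≢ a) → Π! (v ∷ L) D ≡ Π! L D
    others [] _ = refl
    others (a ∷ D) v≢ = cong₂ _*_ (cong _! (count-∷-≢ L (λ a≡v → v≢ (here refl) (sym a≡v)))) (others D (v≢ ∘ there))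

-- Enumerating multisets

tuples : ℕ → List Λ → List (List Λ)
tuples zero D = [] ∷ []
tuples (suc n) D = concatMap (λ u → map (u ∷_) (tuples n D)) D

Unique-tuples : ∀ n {D} → Unique D → Unique (tuples n D)
Unique-tuples zero _ = [] AllPairs.∷ AllPairs.[]
Unique-tuples (suc n) {D} uD = Unique-concatMap _ head uD
  (λ u → Uniqueₚ.map⁺ Listₚ.∷-injectiveʳ (Unique-tuples n uD)) tag
  where
  head : List Λ → Λ
  head [] = 0Λ
  head (u ∷ _) = u
  tag : ∀ {u L} → L ∈ map (u ∷_) (tuples n D) → head L ≡ u
  tag L∈ with _ , _ , refl ← ∈-map⁻ _ L∈ = refl

∈-tuples⁺ : ∀ n {D L} → length L ≡ n → All (_∈ D) L → L ∈ tuples n D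
∈-tuples⁺ zero {L = []} _ _ = here refl
∈-tuples⁺ (suc n) {D} {a ∷ L} len (a∈ ∷ L⊆) = ∈-concatMap⁺ _ (go a∈)
  where
  go : ∀ {D′} → a ∈ D′ → Any (λ u → (a ∷ L) ∈ map (u ∷_) (tuples n D)) D′
  go (here refl) = here (∈-map⁺ (a ∷_) (∈-tuples⁺ n (ℕₚ.suc-injective len) L⊆))
  go (there a∈′) = there (go a∈′)

∈-tuples⁻ : ∀ n {D L} → L ∈ tuples n D → length L ≡ n × All (_∈ D) L
∈-tuples⁻ zero (here refl) = refl , []
∈-tuples⁻ (suc n) {D} {L} L∈ = go (∈-concatMap⁻ _ {xs = D} L∈) (λ u∈ → u∈)
  where
  go : ∀ {D′} → Any (λ u → L ∈ map (u ∷_) (tuples n D)) D′ → (∀ {u} → u ∈ D′ → u ∈ D) →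
       length L ≡ suc n × All (_∈ D) L
  go (there L∈′) sub = go L∈′ (sub ∘ there)
  go (here L∈′) sub with L′ , L′∈ , refl ← ∈-map⁻ _ L∈′ with len , L′⊆ ← ∈-tuples⁻ n L′∈ =
    cong suc len , sub (here refl) ∷ L′⊆

Multiset-≡ : {M M′ : Multiset} → elems M ≡ elems M′ → M ≡ M′
Multiset-≡ {mkMS xs _} {mkMS .xs _} refl = refl

Sorted-elems : ∀ M → Sorted (elems M)
Sorted-elems (mkMS xs s) = mkSorted (recompute (T? _) s)

private
  asMultisetBy : (xs : List Λ) (b : Bool) → sortedB xs ≡ b → List Multiset
  asMultisetBy xs true s = mkMS xs (T-true s) ∷ []
  asMultisetBy xs false _ = []

asMultiset : List Λ → List Multiset
asMultiset xs = asMultisetBy xs (sortedB xs) refl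

∈-asMultiset⁻ : ∀ {xs M} → M ∈ asMultiset xs → elems M ≡ xs
∈-asMultiset⁻ {xs} = go (sortedB xs) refl
  where
  go : ∀ {M} b s → M ∈ asMultisetBy xs b s → elems M ≡ xs
  go true s (here refl) = refl

∈-asMultiset⁺ : ∀ M → M ∈ asMultiset (elems M)
∈-asMultiset⁺ M = go (sortedB (elems M)) refl
  where
  go : ∀ b s → M ∈ asMultisetBy (elems M) b s
  go true s = here (Multiset-≡ refl)
  go false s = ⊥-elim (¬T-false s (Sorted.isSorted (Sorted-elems M)))

Unique-asMultiset : ∀ xs → Unique (asMultiset xs)
Unique-asMultiset xs = go (sortedB xs) refl
  where
  go : ∀ b s → Unique (asMultisetBy xs b s)
  go true s = [] AllPairs.∷ AllPairs.[]
  go false s = AllPairs.[]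

multisets : ℕ → List Λ → List Multiset
multisets n D = concatMap asMultiset (tuples n D)

Unique-multisets : ∀ n {D} → Unique D → Unique (multisets n D)
Unique-multisets n uD = Unique-concatMap asMultiset elems (Unique-tuples n uD) Unique-asMultiset ∈-asMultiset⁻

∈-multisets⁺ : ∀ n {D M} → length (elems M) ≡ n → All (_∈ D) (elems M) → M ∈ multisets n D
∈-multisets⁺ n {D} {M} len M⊆ = ∈-concatMap⁺ asMultiset (go (∈-tuples⁺ n len M⊆))
  where
  go : ∀ {T′} → elems M ∈ T′ → Any (λ xs → M ∈ asMultiset xs) T′
  go (here refl) = here (∈-asMultiset⁺ M)
  go (there M∈) = there (go M∈)

∈-multisets⁻ : ∀ n {D M} → M ∈ multisets n D → length (elems M) ≡ n × All (_∈ D) (elems M)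
∈-multisets⁻ n {D} {M} M∈ = go (∈-concatMap⁻ asMultiset {xs = tuples n D} M∈) (λ xs∈ → xs∈)
  where
  go : ∀ {T′} → Any (λ xs → M ∈ asMultiset xs) T′ → (∀ {xs} → xs ∈ T′ → xs ∈ tuples n D) →
       length (elems M) ≡ n × All (_∈ D) (elems M)
  go (here M∈′) sub rewrite ∈-asMultiset⁻ M∈′ = ∈-tuples⁻ n (sub (here refl))
  go (there M∈′) sub = go M∈′ (sub ∘ there)

insertMS : Λ → Multiset → Multiset
insertMS u M = mkMS (insert u (elems M)) (Sorted.isSorted (Sorted-insert u (Sorted-elems M)))

removeMS : Λ → Multiset → Multiset
removeMS u M = mkMS (remove u (elems M)) (Sorted.isSorted (Sorted-remove u (Sorted-elems M)))

-- Multisets of size n + 1 containing u are exactly the u ∪ M with |M| = n.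
∑-multisets-insert : ∀ n {D u} → Unique D → u ∈ D → (F : Multiset → ℚ) →
  (∀ {M} → F M ≢ 0ℚ → u ∈ elems M) → ∑ (multisets n D) (F ∘ insertMS u) ≡ ∑ (multisets (suc n) D) F
∑-multisets-insert n {D} {u} uD u∈D F F-support =
  ∑-reindex (insertMS u) F (Unique-multisets n uD) (Unique-multisets (suc n) uD) injective (λ _ → into) onto
  where
  open ≡-Reasoning
  injective : ∀ {M M′} → M ∈ multisets n D → M′ ∈ multisets n D → insertMS u M ≡ insertMS u M′ → M ≡ M′
  injective {M} {M′} _ _ e = Multiset-≡ (begin
    elems M                        ≡⟨ remove-insert u (elems M) ⟨
    remove u (insert u (elems M))  ≡⟨ cong (remove u ∘ elems) e ⟩
    remove u (insert u (elems M′)) ≡⟨ remove-insert u (elems M′) ⟩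
    elems M′                       ∎)
  into : ∀ {M} → M ∈ multisets n D → insertMS u M ∈ multisets (suc n) D
  into {M} M∈ with len , M⊆D ← ∈-multisets⁻ n M∈ =
    ∈-multisets⁺ (suc n) (trans (↭ₚ.↭-length (insert-↭ u (elems M))) (cong suc len))
      (↭ₚ.All-resp-↭ (↭.↭-sym (insert-↭ u (elems M))) (u∈D ∷ M⊆D))
  onto : ∀ {M} → F M ≢ 0ℚ → M ∈ multisets (suc n) D → Σ Multiset λ M′ → M′ ∈ multisets n D × insertMS u M′ ≡ M
  onto {M} F≢0 M∈ with len , M⊆D ← ∈-multisets⁻ (suc n) M∈ =
    removeMS u M , ∈-multisets⁺ n len′ (remove-All u M⊆D) , Multiset-≡ (insert-remove (Sorted-elems M) u∈M)
    where
    u∈M = F-support F≢0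
    len′ : length (remove u (elems M)) ≡ n
    len′ = ℕₚ.suc-injective (trans (sym (↭ₚ.↭-length (remove-↭ u∈M))) len)

-- Rational arithmetic with natural numerators and denominators

private
  ℕ/suc-≃ : ∀ n d → toℚᵘ (ℤ.+ n / suc d) ≃ᵘ mkℚᵘ (ℤ.+ n) d
  ℕ/suc-≃ n d = ℚₚ.toℚᵘ-fromℚᵘ (mkℚᵘ (ℤ.+ n) d)

  /-congℕ : ∀ {a a′ b b′} .{{_ : NonZero b}} .{{_ : NonZero b′}} → a ≡ a′ → b ≡ b′ → ℤ.+ a / b ≡ ℤ.+ a′ / b′
  /-congℕ refl refl = refl

/-*-/ : ∀ a b c d .{{_ : NonZero b}} .{{_ : NonZero d}} →
  (ℤ.+ a / b) *ℚ (ℤ.+ c / d) ≡ (ℤ.+ (a * c) / (b * d)) {{ℕₚ.m*n≢0 b d}}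
/-*-/ a (suc b) c (suc d) = ℚₚ.toℚᵘ-injective (ℚᵘₚ.≃-trans (ℚₚ.toℚᵘ-homo-* (ℤ.+ a / suc b) (ℤ.+ c / suc d))
  (ℚᵘₚ.≃-trans (ℚᵘₚ.*-cong (ℕ/suc-≃ a b) (ℕ/suc-≃ c d))
  (ℚᵘₚ.≃-trans (ℚᵘₚ.≃-reflexive (cong (λ z → mkℚᵘ z (ℕ.pred (suc b * suc d))) (sym (ℤₚ.pos-* a c))))
    (ℚᵘₚ.≃-sym (ℕ/suc-≃ (a * c) (ℕ.pred (suc b * suc d)))))))

fromℕ-suc : ∀ n → fromℕ (suc n) ≡ 1ℚ +ℚ fromℕ n
fromℕ-suc n = ℚₚ.toℚᵘ-injective (ℚᵘₚ.≃-trans (ℕ/suc-≃ (suc n) 0) (ℚᵘₚ.≃-sym (ℚᵘₚ.≃-trans (ℚₚ.toℚᵘ-homo-+ 1ℚ (fromℕ n))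
  (ℚᵘₚ.≃-trans (ℚᵘₚ.+-cong (ℕ/suc-≃ 1 0) (ℕ/suc-≃ n 0)) (*≡* (cong (ℤ._* ℤ.+ 1) (cong (ℤ._+_ (ℤ.+ 1)) (ℤₚ.*-identityʳ (ℤ.+ n)))))))))

fromℕ-* : ∀ m n → fromℕ (m * n) ≡ fromℕ m *ℚ fromℕ n
fromℕ-* m n = sym (trans (/-*-/ m 1 n 1) (/-congℕ {m * n} {m * n} {1} {1} refl refl))

/-split : ∀ n d .{{_ : NonZero d}} → ℤ.+ n / d ≡ fromℕ n *ℚ (ℤ.+ 1 / d)
/-split n (suc d) = sym (trans (/-*-/ n 1 1 (suc d)) (/-congℕ (ℕₚ.*-identityʳ n) (ℕₚ.*-identityˡ (suc d))))

1/-* : ∀ c d .{{_ : NonZero c}} .{{_ : NonZero d}} → (ℤ.+ 1 / (c * d)) {{ℕₚ.m*n≢0 c d}} ≡ (ℤ.+ 1 / c) *ℚ (ℤ.+ 1 / d)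
1/-* c d = sym (trans (/-*-/ 1 c 1 d) (/-congℕ {1 * 1} {1} {c * d} {c * d} {{ℕₚ.m*n≢0 c d}} {{ℕₚ.m*n≢0 c d}} refl refl))

1/-cong : ∀ {d d′} .{{_ : NonZero d}} .{{_ : NonZero d′}} → d ≡ d′ → ℤ.+ 1 / d ≡ ℤ.+ 1 / d′
1/-cong refl = refl

fromℕ-*-1/ : ∀ c → fromℕ (suc c) *ℚ (ℤ.+ 1 / suc c) ≡ 1ℚ
fromℕ-*-1/ c = trans (sym (/-split (suc c) (suc c)))
  (ℚₚ.toℚᵘ-injective (ℚᵘₚ.≃-trans (ℕ/suc-≃ (suc c) c) (*≡* (ℤₚ.*-comm (ℤ.+ suc c) (ℤ.+ 1)))))

-- Expanding a product of dilated series over multisets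

∑-by-count : ∀ {D} M (H : Λ → ℚ) → Unique D → All (_∈ D) M →
  ∑ M H ≡ ∑ D (λ u → fromℕ (count u M) *ℚ H u)
∑-by-count {D} [] H uD _ = sym (∑-zero D (λ {u} _ → ℚₚ.*-zeroˡ (H u)))
∑-by-count {D} (v ∷ M) H uD (v∈D ∷ M⊆D) = begin
  H v +ℚ ∑ M H
    ≡⟨ cong₂ _+ℚ_ (sym (trans (∑-singleton-support onlyV uD v∈D onlyV-support) onlyV-v)) (∑-by-count M H uD M⊆D) ⟩
  ∑ D onlyV +ℚ ∑ D (λ u → fromℕ (count u M) *ℚ H u)
    ≡⟨ ∑-+ D onlyV _ ⟨
  ∑ D (λ u → onlyV u +ℚ fromℕ (count u M) *ℚ H u)
    ≡⟨ ∑-cong D (λ {u} _ → one-more u) ⟩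
  ∑ D (λ u → fromℕ (count u (v ∷ M)) *ℚ H u)
    ∎
  where
  open ≡-Reasoning
  onlyV : Λ → ℚ
  onlyV u = if does (u ≟Λ v) then H v else 0ℚ
  onlyV-v : onlyV v ≡ H v
  onlyV-v with v ≟Λ v
  ... | yes _ = refl
  ... | no v≢v = ⊥-elim (v≢v refl)
  onlyV-support : ∀ {u} → onlyV u ≢ 0ℚ → u ≡ v
  onlyV-support {u} ne with u ≟Λ v
  ... | yes u≡v = u≡v
  ... | no _ = ⊥-elim (ne refl)
  one-more : ∀ u → onlyV u +ℚ fromℕ (count u M) *ℚ H u ≡ fromℕ (count u (v ∷ M)) *ℚ H u
  one-more u with u ≟Λ v
  ... | yes refl = trans (cong (_+ℚ fromℕ (count u M) *ℚ H u) (sym (ℚₚ.*-identityˡ (H u))))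
                     (trans (sym (ℚₚ.*-distribʳ-+ (H u) 1ℚ (fromℕ (count u M)))) (cong (_*ℚ H u) (sym (fromℕ-suc (count u M)))))
  ... | no _ = ℚₚ.+-identityˡ _

∑select-by-count : ∀ {D} M (G : Λ → List Λ → ℚ) → Unique D → All (_∈ D) M →
  (∀ v {r r′} → r ↭ r′ → G v r ≡ G v r′) →
  ∑select M G ≡ ∑ D (λ u → fromℕ (count u M) *ℚ G u (remove u M))
∑select-by-count {D} M G uD M⊆D G-resp = begin
  ∑select M G
    ≡⟨ ∑-cong (select M) (λ { {v , r} vr∈ → G-resp v (r↭ vr∈) }) ⟩
  ∑ (select M) (λ vr → G (proj₁ vr) (remove (proj₁ vr) M))
    ≡⟨ ∑-map (select M) proj₁ (λ v → G v (remove v M)) ⟨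
  ∑ (map proj₁ (select M)) (λ v → G v (remove v M))
    ≡⟨ cong (λ L → ∑ L (λ v → G v (remove v M))) (map-proj₁-select M) ⟩
  ∑ M (λ v → G v (remove v M))
    ≡⟨ ∑-by-count M _ uD M⊆D ⟩
  ∑ D (λ u → fromℕ (count u M) *ℚ G u (remove u M))
    ∎
  where
  open ≡-Reasoning
  r↭ : ∀ {v r} → (v , r) ∈ select M → r ↭ remove v M
  r↭ {v} vr∈ = ↭ₚ.drop-∷ (↭.trans (↭.↭-sym (select-↭ M vr∈))
    (remove-↭ (subst (v ∈_) (map-proj₁-select M) (∈-map⁺ proj₁ vr∈))))

productℚ-↭ : ∀ {L L′} → L ↭ L′ → productℚ L ≡ productℚ L′
productℚ-↭ p = ↭ₛₚ.foldr-commMonoid (setoid ℚ) ℚₚ.*-1-isCommutativeMonoid (↭⇒↭ₛ p)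

1/rep : List Λ → ℚ
1/rep L = (ℤ.+ 1 / repFactor L) {{repFactor-nonZero L}}

1/rep-insert : ∀ u L → 1/rep (insert u L) ≡ (ℤ.+ 1 / suc (count u L)) *ℚ 1/rep L
1/rep-insert u L =
  trans (1/-cong {{repFactor-nonZero (insert u L)}} {{ℕₚ.m*n≢0 (suc (count u L)) _ {{_}} {{repFactor-nonZero L}}}} (repFactor-insert u L))
    (1/-* (suc (count u L)) (repFactor L) {{_}} {{repFactor-nonZero L}})

coefficient : (Λ → ℚ) → List Λ → ℚ
coefficient w L = productℚ (map w L) *ℚ 1/rep L

coefficient-insert : ∀ w u L → fromℕ (count u (insert u L)) *ℚ coefficient w (insert u L) ≡ w u *ℚ coefficient w L
coefficient-insert w u L = begin
  fromℕ (count u (insert u L)) *ℚ coefficient w (insert u L)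
    ≡⟨ cong₂ _*ℚ_ (cong fromℕ (count-insert u L))
                  (cong₂ _*ℚ_ (productℚ-↭ (↭ₚ.map⁺ w (insert-↭ u L))) (1/rep-insert u L)) ⟩
  fromℕ (suc c) *ℚ ((w u *ℚ productℚ (map w L)) *ℚ ((ℤ.+ 1 / suc c) *ℚ 1/rep L))
    ≡⟨ regroup (fromℕ (suc c)) (w u) (productℚ (map w L)) (ℤ.+ 1 / suc c) (1/rep L) ⟩
  (w u *ℚ coefficient w L) *ℚ (fromℕ (suc c) *ℚ (ℤ.+ 1 / suc c))
    ≡⟨ cong ((w u *ℚ coefficient w L) *ℚ_) (fromℕ-*-1/ c) ⟩
  (w u *ℚ coefficient w L) *ℚ 1ℚ
    ≡⟨ ℚₚ.*-identityʳ _ ⟩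
  w u *ℚ coefficient w L
    ∎
  where
  open ≡-Reasoning
  c = count u L
  regroup : ∀ a x P i R → a *ℚ ((x *ℚ P) *ℚ (i *ℚ R)) ≡ (x *ℚ (P *ℚ R)) *ℚ (a *ℚ i)
  regroup = solve 5 (λ a x P i R → a :* ((x :* P) :* (i :* R)) := (x :* (P :* R)) :* (a :* i)) refl
    where open +-*-Solver

module MultisetExpansion (w : Λ → ℚ) {D : List Λ} (uD : Unique D) where

  expansion : List (ℕ × ℕ) → Λ → ℚ
  expansion S τ = ∑ (multisets (length S) D) (λ M → countT S (elems M) τ *ℚ coefficient w (elems M))

  private
    module _ (k : ℕ) (S : List (ℕ × ℕ)) (τ : Λ) where

      rest : Λ → List Λ → ℚ
      rest u r = ifBelow (V k u) τ (countT S r (τ ∸Λ V k u))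

      countT-by-count : ∀ x M → proj₁ x ≡ k → All (_∈ D) M →
        countT (x ∷ S) M τ ≡ ∑ D (λ u → fromℕ (count u M) *ℚ rest u (remove u M))
      countT-by-count x M refl M⊆D = trans (countT-∷ x S M τ)
        (∑select-by-count M rest uD M⊆D (λ u p → cong (ifBelow (V k u) τ) (countT-resp-↭ S (τ ∸Λ V k u) p)))

      ∑-removing : ∀ {u} → u ∈ D →
        ∑ (multisets (suc (length S)) D) (λ M → (fromℕ (count u (elems M)) *ℚ rest u (remove u (elems M))) *ℚ coefficient w (elems M))
        ≡ w u *ℚ ifBelow (V k u) τ (expansion S (τ ∸Λ V k u))
      ∑-removing {u} u∈D = begin
        ∑ (multisets (suc m) D) F
          ≡⟨ ∑-multisets-insert m uD u∈D F (λ {M} → F-support {M}) ⟨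
        ∑ (multisets m D) (F ∘ insertMS u)
          ≡⟨ ∑-cong (multisets m D) (λ {M} _ → at-insert (elems M)) ⟩
        ∑ (multisets m D) (λ M → w u *ℚ (rest u (elems M) *ℚ coefficient w (elems M)))
          ≡⟨ ∑-*ˡ (multisets m D) (w u) _ ⟩
        w u *ℚ ∑ (multisets m D) (λ M → rest u (elems M) *ℚ coefficient w (elems M))
          ≡⟨ cong (w u *ℚ_) (∑-cong (multisets m D) (λ {M} _ → ifBelow-*ʳ (V k u) τ _ (coefficient w (elems M)))) ⟩
        w u *ℚ ∑ (multisets m D) (λ M → ifBelow (V k u) τ (countT S (elems M) (τ ∸Λ V k u) *ℚ coefficient w (elems M)))
          ≡⟨ cong (w u *ℚ_) (ifBelow-∑ (V k u) τ (multisets m D) _) ⟩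
        w u *ℚ ifBelow (V k u) τ (expansion S (τ ∸Λ V k u))
          ∎
        where
        open ≡-Reasoning
        m = length S
        F : Multiset → ℚ
        F M = (fromℕ (count u (elems M)) *ℚ rest u (remove u (elems M))) *ℚ coefficient w (elems M)
        F-support : ∀ {M} → F M ≢ 0ℚ → u ∈ elems M
        F-support {M} F≢0 = count≢0⇒∈ u (elems M) λ c≡0 → F≢0 (begin
          F M                                                          ≡⟨ cong (λ c → (fromℕ c *ℚ rest u (remove u (elems M))) *ℚ coefficient w (elems M)) c≡0 ⟩
          (0ℚ *ℚ rest u (remove u (elems M))) *ℚ coefficient w (elems M) ≡⟨ cong (_*ℚ coefficient w (elems M)) (ℚₚ.*-zeroˡ (rest u (remove u (elems M)))) ⟩
          0ℚ *ℚ coefficient w (elems M)                                ≡⟨ ℚₚ.*-zeroˡ (coefficient w (elems M)) ⟩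
          0ℚ                                                           ∎)
        at-insert : ∀ L → (fromℕ (count u (insert u L)) *ℚ rest u (remove u (insert u L))) *ℚ coefficient w (insert u L)
                          ≡ w u *ℚ (rest u L *ℚ coefficient w L)
        at-insert L = begin
          (fromℕ (count u (insert u L)) *ℚ rest u (remove u (insert u L))) *ℚ coefficient w (insert u L)
            ≡⟨ cong (λ r → (fromℕ (count u (insert u L)) *ℚ rest u r) *ℚ coefficient w (insert u L)) (remove-insert u L) ⟩
          (fromℕ (count u (insert u L)) *ℚ rest u L) *ℚ coefficient w (insert u L)
            ≡⟨ ℚ*.xy∙z≈y∙xz (fromℕ (count u (insert u L))) (rest u L) (coefficient w (insert u L)) ⟩
          rest u L *ℚ (fromℕ (count u (insert u L)) *ℚ coefficient w (insert u L))
            ≡⟨ cong (rest u L *ℚ_) (coefficient-insert w u L) ⟩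
          rest u L *ℚ (w u *ℚ coefficient w L)
            ≡⟨ ℚ*.x∙yz≈y∙xz (rest u L) (w u) (coefficient w L) ⟩
          w u *ℚ (rest u L *ℚ coefficient w L)
            ∎

  expansion-∷ : ∀ x S τ →
    expansion (x ∷ S) τ ≡ ∑ D (λ u → w u *ℚ ifBelow (V (proj₁ x) u) τ (expansion S (τ ∸Λ V (proj₁ x) u)))
  expansion-∷ x S τ = begin
    ∑ Ms (λ M → countT (x ∷ S) (elems M) τ *ℚ coefficient w (elems M))
      ≡⟨ ∑-cong Ms (λ M∈ → trans (cong (_*ℚ _) (countT-by-count k S τ x _ refl (proj₂ (∈-multisets⁻ (suc (length S)) M∈)))) (sym (∑-*ʳ D _ _))) ⟩
    ∑ Ms (λ M → ∑ D (λ u → (fromℕ (count u (elems M)) *ℚ rest k S τ u (remove u (elems M))) *ℚ coefficient w (elems M)))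
      ≡⟨ ∑-comm Ms D _ ⟩
    ∑ D (λ u → ∑ Ms (λ M → (fromℕ (count u (elems M)) *ℚ rest k S τ u (remove u (elems M))) *ℚ coefficient w (elems M)))
      ≡⟨ ∑-cong D (∑-removing k S τ) ⟩
    ∑ D (λ u → w u *ℚ ifBelow (V k u) τ (expansion S (τ ∸Λ V k u)))
      ∎
    where
    open ≡-Reasoning
    k = proj₁ x
    Ms = multisets (suc (length S)) D

-- A finite list containing every element of weight at most W.
lighter : ℕ → List Λ
lighter W = below (toΛ (replicate W W))

Unique-lighter : ∀ W → Unique (lighter W)
Unique-lighter W = Unique-below (toΛ (replicate W W))

∈-lighter : ∀ {W u} → weight u ≤ W → u ∈ lighter W
∈-lighter {W} {u} u≤W = ∈-below⁺ (toΛ (replicate W W)) u≤bound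
  where
  at-replicate : ∀ n x {i} → i < n → at (replicate n x) i ≡ x
  at-replicate (suc n) x {zero} _ = refl
  at-replicate (suc n) x {suc i} (s≤s i<n) = at-replicate n x i<n
  u≤bound : u ≤Λ toΛ (replicate W W)
  u≤bound i with i ℕ.<? W
  ... | yes i<W = subst (coord u i ≤_) (sym (trans (coord-toΛ (replicate W W) i) (at-replicate W W i<W)))
                    (ℕₚ.≤-trans (coord≤weight u i) u≤W)
  ... | no i≮W = subst (_≤ _) (sym coord≡0) z≤n
    where
    coord≡0 : coord u i ≡ 0
    coord≡0 with coord u i in e
    ... | zero = refl
    ... | suc c = ⊥-elim (i≮W (ℕₚ.≤-trans (ℕₚ.m≤n*m (suc i) (suc c))
                   (subst (λ z → z * suc i ≤ W) e (ℕₚ.≤-trans (coord*index≤weight u i) u≤W))))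

module _ (σ : Λ) (p : Ser) where

  open MultisetExpansion p (Unique-lighter (weight σ))

  private
    D = lighter (weight σ)

    expansion-[] : ∀ τ → oneSer τ ≡ expansion [] τ
    expansion-[] τ with τ ≟Λ 0Λ | 0Λ ≟Λ τ
    ... | yes refl | yes _ = refl
    ... | yes refl | no 0≢0 = ⊥-elim (0≢0 refl)
    ... | no τ≢0 | yes 0≡τ = ⊥-elim (τ≢0 (sym 0≡τ))
    ... | no _ | no _ = refl

    weight-below-V : ∀ k {τ u} → τ ≤Λ σ → V (suc k) u ≤Λ τ → weight u ≤ weight σ
    weight-below-V k {τ} {u} τ≤σ Vu≤τ = begin
      weight u              ≤⟨ ℕₚ.m≤n*m (weight u) (suc k) ⟩
      suc k * weight u      ≡⟨ weight-V k u ⟨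
      weight (V (suc k) u)  ≤⟨ weight-mono (V (suc k) u) τ Vu≤τ ⟩
      weight τ              ≤⟨ weight-mono τ σ τ≤σ ⟩
      weight σ              ∎
      where open ℕₚ.≤-Reasoning

  slotProduct≡expansion : ∀ S → All (λ x → 1 ≤ proj₁ x) S → ∀ τ → τ ≤Λ σ → slotProduct p S τ ≡ expansion S τ
  slotProduct≡expansion [] _ τ _ = expansion-[] τ
  slotProduct≡expansion ((suc k , j) ∷ S) (_ ∷ S≥1) τ τ≤σ = begin
    (dilate (suc k) p ⋆ slotProduct p S) τ
      ≡⟨ dilate-⋆ k p (slotProduct p S) τ (Unique-lighter (weight σ)) (λ {u} Vu≤τ _ → ∈-lighter (weight-below-V k {τ} {u} τ≤σ Vu≤τ)) ⟩
    ∑ D (λ u → p u *ℚ ifBelow (Vₖ u) τ (slotProduct p S (τ ∸Λ Vₖ u)))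
      ≡⟨ ∑-cong D (λ {u} _ → cong (p u *ℚ_) (ifBelow-cong (Vₖ u) τ λ _ →
           slotProduct≡expansion S S≥1 (τ ∸Λ Vₖ u) (≤Λ-trans {τ ∸Λ Vₖ u} {τ} {σ} (∸Λ-≤ τ (Vₖ u)) τ≤σ))) ⟩
    ∑ D (λ u → p u *ℚ ifBelow (Vₖ u) τ (expansion S (τ ∸Λ Vₖ u)))
      ≡⟨ expansion-∷ (suc k , j) S τ ⟨
    expansion ((suc k , j) ∷ S) τ
      ∎
    where
    open ≡-Reasoning
    Vₖ = V (suc k)

-- The weight bound on the support

private
  insertAll-↭ : {A : Set} (x : A) (p : List A) {q : List A} → q ∈ insertAll x p → q ↭ x ∷ p
  insertAll-↭ x [] (here refl) = ↭.refl
  insertAll-↭ x (y ∷ ys) (here refl) = ↭.refl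
  insertAll-↭ x (y ∷ ys) (there q∈) with q′ , q′∈ , refl ← ∈-map⁻ _ q∈ =
    ↭.trans (↭.prep y (insertAll-↭ x ys q′∈)) (↭.swap y x ↭.refl)

perms-↭ : {A : Set} (S : List A) {q : List A} → q ∈ perms S → q ↭ S
perms-↭ [] (here refl) = ↭.refl
perms-↭ (x ∷ S) {q} q∈ = go (∈-concatMap⁻ (insertAll x) {xs = perms S} q∈) (λ p∈ → p∈)
  where
  go : ∀ {L} → Any (λ p → q ∈ insertAll x p) L → (∀ {p} → p ∈ L → p ∈ perms S) → q ↭ x ∷ S
  go (here q∈′) sub = ↭.trans (insertAll-↭ x _ q∈′) (↭.prep x (perms-↭ S (sub (here refl))))
  go (there q∈′) sub = go q∈′ (sub ∘ there)

All-slots-positive : ∀ a → All (λ x → 1 ≤ proj₁ x) (slots a)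
All-slots-positive a = go 1 (entries a) (s≤s z≤n)
  where
  go : ∀ k as → 1 ≤ k → All (λ x → 1 ≤ proj₁ x) (slotsFrom k as)
  go k [] _ = []
  go k (a ∷ as) 1≤k = Allₚ.++⁺ (Allₚ.map⁺ (All.tabulate (λ _ → 1≤k))) (go (suc k) as (ℕₚ.m≤n⇒m≤1+n 1≤k))

length-slots : ∀ a → length (slots a) ≡ ∣ a ∣Λ
length-slots a = go 1 (entries a)
  where
  go : ∀ k as → length (slotsFrom k as) ≡ sum as
  go k [] = refl
  go k (a ∷ as) = trans (Listₚ.length-++ (map (λ j → (k , suc j)) (upTo a)))
    (cong₂ _+_ (trans (Listₚ.length-map (λ j → (k , suc j)) (upTo a)) (Listₚ.length-upTo a)) (go (suc k) as))

-- weight (Σ_i V^{k_i} μ_i) = Σ_i k_i · weight μ_i, which bounds both Σ_i k_i and each weight μ_i.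
weight-vsum : ∀ ps L → All (λ x → 1 ≤ proj₁ x) ps → All (_≢ 0Λ) L → length ps ≡ length L →
  sum (map proj₁ ps) ≤ weight (vsum ps L) × All (λ μ → weight μ ≤ weight (vsum ps L)) L
weight-vsum [] [] _ _ _ = z≤n , []
weight-vsum ((suc k , j) ∷ ps) (μ ∷ L) (_ ∷ ps≥1) (μ≢0 ∷ L≢0) len
  rewrite weight-+ (V (suc k) μ) (vsum ps L) | weight-V k μ
  with ∑≤ , L≤ ← weight-vsum ps L ps≥1 L≢0 (ℕₚ.suc-injective len) =
  ℕₚ.+-mono-≤ (subst (_≤ suc k * weight μ) (ℕₚ.*-identityʳ (suc k)) (ℕₚ.*-monoʳ-≤ (suc k) (weight-pos μ μ≢0))) ∑≤ ,
  ℕₚ.≤-trans (ℕₚ.m≤n*m (weight μ) (suc k)) (ℕₚ.m≤m+n _ _) ∷ All.map (λ le → ℕₚ.≤-trans le (ℕₚ.m≤n+m _ _)) L≤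

T-support : ∀ {σ a L ps} → ps ∈ perms (slots a) → length L ≡ length (slots a) → All (_≢ 0Λ) L → vsum ps L ≡ σ →
  a ∈ lighter (weight σ) × All (_∈ lighter (weight σ)) L
T-support {σ} {a} {L} {ps} ps∈ len L≢0 refl
  with ∑≤ , L≤ ← weight-vsum ps L (↭ₚ.All-resp-↭ (↭.↭-sym (perms-↭ (slots a) ps∈)) (All-slots-positive a)) L≢0
                   (trans (length-perms (slots a) ps∈) (sym len)) =
  ∈-lighter (subst (_≤ weight σ) a-weight ∑≤) , All.map ∈-lighter L≤
  where
  a-weight : sum (map proj₁ ps) ≡ weight a
  a-weight = trans (ListActionₚ.sum-↭ (↭ₚ.map⁺ proj₁ (perms-↭ (slots a) ps∈))) (∑slots≡weight a)

-- Matching the two sides term by term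

private
  allNonzero : List Λ → Bool
  allNonzero = Data.List.foldr (λ m r → not (isZeroΛ m) ∧ r) true

  allNonzero-true : ∀ L → allNonzero L ≡ true → All (_≢ 0Λ) L
  allNonzero-true [] _ = []
  allNonzero-true (m ∷ L) e with m ≟Λ 0Λ
  ... | no m≢0 = m≢0 ∷ allNonzero-true L e

  allNonzero-false : ∀ L → allNonzero L ≡ false → 0Λ ∈ L
  allNonzero-false (m ∷ L) e with m ≟Λ 0Λ
  ... | yes refl = here refl
  ... | no _ = there (allNonzero-false L e)

  ≡ᵇ-refl : ∀ n → (n ℕ.≡ᵇ n) ≡ true
  ≡ᵇ-refl zero = refl
  ≡ᵇ-refl (suc n) = ≡ᵇ-refl n

  validIndex-matched : ∀ {a} M → a ≢ 0Λ → length (elems M) ≡ ∣ a ∣Λ → validIndex a M ≡ allNonzero (elems M)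
  validIndex-matched {a} M a≢0 len with a ≟Λ 0Λ
  ... | yes a≡0 = ⊥-elim (a≢0 a≡0)
  ... | no _ rewrite len | ≡ᵇ-refl ∣ a ∣Λ = refl

1/aut : Λ → ℚ
1/aut m = (ℤ.+ 1 / aut m) {{aut-nz m}}

1/autMS : ∀ M → (ℤ.+ 1 / autMS M) {{autMS-nz M}} ≡ productℚ (map 1/aut (elems M)) *ℚ 1/rep (elems M)
1/autMS M = trans (1/-* (product (map aut (elems M))) (repSize M) {{Πaut-nonZero (elems M)}} {{repSize-nonZero}})
  (cong₂ _*ℚ_ (1/Πaut (elems M)) (1/-cong {{repSize-nonZero}} {{repFactor-nonZero (elems M)}} (repSize≡repFactor M)))
  where
  Πaut-nonZero : ∀ L → NonZero (product (map aut L))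
  Πaut-nonZero [] = _
  Πaut-nonZero (m ∷ L) = ℕₚ.m*n≢0 _ _ {{aut-nz m}} {{Πaut-nonZero L}}
  1/Πaut : ∀ L → (ℤ.+ 1 / product (map aut L)) {{Πaut-nonZero L}} ≡ productℚ (map 1/aut L)
  1/Πaut [] = refl
  1/Πaut (m ∷ L) = trans (1/-* (aut m) (product (map aut L)) {{aut-nz m}} {{Πaut-nonZero L}}) (cong (1/aut m *ℚ_) (1/Πaut L))
  repSize-nonZero : NonZero (repSize M)
  repSize-nonZero = subst NonZero (sym (repSize≡repFactor M)) (repFactor-nonZero (elems M))

module _ (f : PowerSeries) where

  product-ordinary : ∀ L → All (_≢ 0Λ) L → productℚ (map (ordinary f) L) ≡ productℚ (map f L) *ℚ productℚ (map 1/aut L)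
  product-ordinary [] [] = refl
  product-ordinary (m ∷ L) (m≢0 ∷ L≢0) with m ≟Λ 0Λ
  ... | yes m≡0 = ⊥-elim (m≢0 m≡0)
  ... | no _ = trans (cong ((f m *ℚ 1/aut m) *ℚ_) (product-ordinary L L≢0))
                     (ℚ*.interchange (f m) (1/aut m) (productℚ (map f L)) (productℚ (map 1/aut L)))

  product-ordinary-0 : ∀ {L} → 0Λ ∈ L → productℚ (map (ordinary f) L) ≡ 0ℚ
  product-ordinary-0 {m ∷ L} (here refl) = ℚₚ.*-zeroˡ (productℚ (map (ordinary f) L))
  product-ordinary-0 {m ∷ L} (there 0∈L) = trans (cong (ordinary f m *ℚ_) (product-ordinary-0 0∈L)) (ℚₚ.*-zeroʳ (ordinary f m))

private
  fromℕ-length-filter : ∀ (h : List (ℕ × ℕ) → Λ) σ Ps →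
    fromℕ (length (filter (λ ps → h ps ≟Λ σ) Ps)) ≡ ∑ Ps (λ ps → δ (h ps) σ)
  fromℕ-length-filter h σ [] = refl
  fromℕ-length-filter h σ (q ∷ Ps) with h q ≟Λ σ
  ... | yes _ = trans (fromℕ-suc (length (filter (λ ps → h ps ≟Λ σ) Ps))) (cong (1ℚ +ℚ_) (fromℕ-length-filter h σ Ps))
  ... | no _ = trans (fromℕ-length-filter h σ Ps) (sym (ℚₚ.+-identityˡ (∑ Ps (λ ps → δ (h ps) σ))))

fromℕ-Tcount : ∀ σ a M → length (elems M) ≡ length (slots a) → fromℕ (Tcount σ a M) ≡ countT (slots a) (elems M) σ
fromℕ-Tcount σ a M len =
  trans (fromℕ-length-filter (λ ps → vsum ps (elems M)) σ (perms (slots a))) (sym (countT-matched (slots a) (elems M) σ len))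

module _ (f g : PowerSeries) (σ : Λ) where

  private
    rearrange : ∀ (Aσ T Aa AM : ℕ) .{{_ : NonZero Aa}} .{{_ : NonZero AM}} (Πf Πi r ga : ℚ) →
      (ℤ.+ 1 / AM) ≡ Πi *ℚ r →
      ((ℤ.+ (Aσ * T) / (Aa * AM)) {{ℕₚ.m*n≢0 Aa AM}} *ℚ Πf) *ℚ ga
        ≡ fromℕ Aσ *ℚ ((ga *ℚ (ℤ.+ 1 / Aa)) *ℚ (fromℕ T *ℚ ((Πf *ℚ Πi) *ℚ r)))
    rearrange Aσ T Aa AM Πf Πi r ga 1/AM≡ = begin
      ((ℤ.+ (Aσ * T) / (Aa * AM)) {{ℕₚ.m*n≢0 Aa AM}} *ℚ Πf) *ℚ ga
        ≡⟨ cong (λ z → (z *ℚ Πf) *ℚ ga) (trans (/-split (Aσ * T) (Aa * AM) {{ℕₚ.m*n≢0 Aa AM}})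
             (cong₂ _*ℚ_ (fromℕ-* Aσ T) (trans (1/-* Aa AM) (cong ((ℤ.+ 1 / Aa) *ℚ_) 1/AM≡)))) ⟩
      ((fromℕ Aσ *ℚ fromℕ T) *ℚ ((ℤ.+ 1 / Aa) *ℚ (Πi *ℚ r))) *ℚ Πf *ℚ ga
        ≡⟨ solve 7 (λ A T iA iP r F G → ((A :* T) :* (iA :* (iP :* r))) :* F :* G
                                      := A :* ((G :* iA) :* (T :* ((F :* iP) :* r)))) refl
             (fromℕ Aσ) (fromℕ T) (ℤ.+ 1 / Aa) Πi r Πf ga ⟩
      fromℕ Aσ *ℚ ((ga *ℚ (ℤ.+ 1 / Aa)) *ℚ (fromℕ T *ℚ ((Πf *ℚ Πi) *ℚ r)))
        ∎
      where
      open ≡-Reasoning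
      open +-*-Solver

  rhsTerm-matched : ∀ a M → a ≢ 0Λ → length (elems M) ≡ ∣ a ∣Λ →
    rhsTerm f g σ (a , M)
      ≡ fromℕ (aut σ) *ℚ ((g a *ℚ 1/aut a) *ℚ (countT (slots a) (elems M) σ *ℚ coefficient (ordinary f) (elems M)))
  rhsTerm-matched a M a≢0 len =
    trans (cong (λ b → if b then X else 0ℚ) (validIndex-matched M a≢0 len)) (go (allNonzero (elems M)) refl)
    where
    L = elems M
    X : ℚ
    X = ((ℤ.+ (aut σ * Tcount σ a M) / (aut a * autMS M)) {{ℕₚ.m*n≢0 _ _ {{aut-nz a}} {{autMS-nz M}}}}
          *ℚ productℚ (map f L)) *ℚ g a
    countT≡ : countT (slots a) L σ ≡ fromℕ (Tcount σ a M)
    countT≡ = sym (fromℕ-Tcount σ a M (trans len (sym (length-slots a))))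
    go : ∀ b → allNonzero L ≡ b →
      (if b then X else 0ℚ) ≡ fromℕ (aut σ) *ℚ ((g a *ℚ 1/aut a) *ℚ (countT (slots a) L σ *ℚ coefficient (ordinary f) L))
    go true nz = begin
      X
        ≡⟨ rearrange (aut σ) (Tcount σ a M) (aut a) (autMS M) {{aut-nz a}} {{autMS-nz M}}
             (productℚ (map f L)) (productℚ (map 1/aut L)) (1/rep L) (g a) (1/autMS M) ⟩
      fromℕ (aut σ) *ℚ ((g a *ℚ 1/aut a) *ℚ (fromℕ (Tcount σ a M) *ℚ ((productℚ (map f L) *ℚ productℚ (map 1/aut L)) *ℚ 1/rep L)))
        ≡⟨ cong₂ (λ t q → fromℕ (aut σ) *ℚ ((g a *ℚ 1/aut a) *ℚ (t *ℚ (q *ℚ 1/rep L))))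
                 (sym countT≡) (sym (product-ordinary f L (allNonzero-true L nz))) ⟩
      fromℕ (aut σ) *ℚ ((g a *ℚ 1/aut a) *ℚ (countT (slots a) L σ *ℚ coefficient (ordinary f) L))
        ∎
      where open ≡-Reasoning
    go false z = sym (begin
      fromℕ (aut σ) *ℚ ((g a *ℚ 1/aut a) *ℚ (countT (slots a) L σ *ℚ (productℚ (map (ordinary f) L) *ℚ 1/rep L)))
        ≡⟨ cong (λ q → fromℕ (aut σ) *ℚ ((g a *ℚ 1/aut a) *ℚ (countT (slots a) L σ *ℚ (q *ℚ 1/rep L))))
                (product-ordinary-0 f (allNonzero-false L z)) ⟩
      fromℕ (aut σ) *ℚ ((g a *ℚ 1/aut a) *ℚ (countT (slots a) L σ *ℚ (0ℚ *ℚ 1/rep L)))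
        ≡⟨ solve 4 (λ A G T R → A :* (G :* (T :* (con 0ℚ :* R))) := con 0ℚ) refl
             (fromℕ (aut σ)) (g a *ℚ 1/aut a) (countT (slots a) L σ) (1/rep L) ⟩
      0ℚ
        ∎)
      where
      open ≡-Reasoning
      open +-*-Solver

  private
    D = lighter (weight σ)

    open MultisetExpansion (ordinary f) (Unique-lighter (weight σ))

  multisetsFor : Λ → List Multiset
  multisetsFor a = multisets (length (slots a)) D

  private

    plethTerm-expansion : ∀ a → a ≢ 0Λ → plethTerm f g σ a ≡ (g a *ℚ 1/aut a) *ℚ expansion (slots a) σ
    plethTerm-expansion a a≢0 with a ≟Λ 0Λ
    ... | yes a≡0 = ⊥-elim (a≢0 a≡0)
    ... | no _ = cong ((g a *ℚ 1/aut a) *ℚ_)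
      (trans (prodDilates≗slotProduct (ordinary f) 1 (entries a) σ)
             (slotProduct≡expansion σ (ordinary f) (slots a) (All-slots-positive a) σ (λ _ → ℕₚ.≤-refl)))

    ≢0-*ˡ : ∀ {x y} → x *ℚ y ≢ 0ℚ → x ≢ 0ℚ
    ≢0-*ˡ {x} {y} ne x≡0 = ne (trans (cong (_*ℚ y) x≡0) (ℚₚ.*-zeroˡ y))

    ≢0-*ʳ : ∀ {x y} → x *ℚ y ≢ 0ℚ → y ≢ 0ℚ
    ≢0-*ʳ {x} {y} ne y≡0 = ne (trans (cong (x *ℚ_) y≡0) (ℚₚ.*-zeroʳ x))

    term-support : ∀ {a} M → length (elems M) ≡ length (slots a) →
      countT (slots a) (elems M) σ *ℚ coefficient (ordinary f) (elems M) ≢ 0ℚ → a ∈ D × All (_∈ D) (elems M)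
    term-support {a} M len ne
      with ps , ps∈ , δ≢0 ← ∑-nonzero (perms (slots a)) (λ ps → δ (vsum ps (elems M)) σ)
                              (λ e → ≢0-*ˡ ne (trans (countT-matched (slots a) (elems M) σ len) e)) =
      T-support ps∈ len nonzero (δ-nonzero _ σ δ≢0)
      where
      nonzero : All (_≢ 0Λ) (elems M)
      nonzero = All.tabulate λ μ∈ μ≡0 →
        ≢0-*ˡ {y = 1/rep (elems M)} (≢0-*ʳ {countT (slots a) (elems M) σ} ne) (product-ordinary-0 f (subst (_∈ elems M) μ≡0 μ∈))

    valid-support : ∀ {a M} → rhsTerm f g σ (a , M) ≢ 0ℚ → T (validIndex a M)
    valid-support {a} {M} ne with validIndex a M
    ... | true = tt
    ... | false = ne refl

  ∑-rhsTerm : ∀ a → ∑ (multisetsFor a) (λ M → rhsTerm f g σ (a , M)) ≡ fromℕ (aut σ) *ℚ plethTerm f g σ a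
  ∑-rhsTerm a = by-cases (a ≟Λ 0Λ)
    where
    by-cases : Dec (a ≡ 0Λ) → ∑ (multisetsFor a) (λ M → rhsTerm f g σ (a , M)) ≡ fromℕ (aut σ) *ℚ plethTerm f g σ a
    by-cases (yes refl) = trans (∑-zero (multisetsFor 0Λ) (λ _ → refl)) (sym (ℚₚ.*-zeroʳ (fromℕ (aut σ))))
    by-cases (no a≢0) = begin
      ∑ (multisetsFor a) (λ M → rhsTerm f g σ (a , M))
        ≡⟨ ∑-cong (multisetsFor a) (λ {M} M∈ → rhsTerm-matched a M a≢0
             (trans (proj₁ (∈-multisets⁻ (length (slots a)) M∈)) (length-slots a))) ⟩
      ∑ (multisetsFor a) (λ M → fromℕ (aut σ) *ℚ (ga *ℚ (countT (slots a) (elems M) σ *ℚ coefficient (ordinary f) (elems M))))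
        ≡⟨ ∑-*ˡ (multisetsFor a) (fromℕ (aut σ)) _ ⟩
      fromℕ (aut σ) *ℚ ∑ (multisetsFor a) (λ M → ga *ℚ (countT (slots a) (elems M) σ *ℚ coefficient (ordinary f) (elems M)))
        ≡⟨ cong (fromℕ (aut σ) *ℚ_) (∑-*ˡ (multisetsFor a) ga _) ⟩
      fromℕ (aut σ) *ℚ (ga *ℚ expansion (slots a) σ)
        ≡⟨ cong (fromℕ (aut σ) *ℚ_) (plethTerm-expansion a a≢0) ⟨
      fromℕ (aut σ) *ℚ plethTerm f g σ a
        ∎
      where
      open ≡-Reasoning
      ga = g a *ℚ 1/aut a

  plethTerm-support : ∀ {a} → plethTerm f g σ a ≢ 0ℚ → a ∈ D
  plethTerm-support {a} ne = proj₁ (term-support M (proj₁ (∈-multisets⁻ (length (slots a)) M∈)) term≢0)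
    where
    a≢0 : a ≢ 0Λ
    a≢0 refl = ne refl
    found = ∑-nonzero (multisetsFor a) (λ M → countT (slots a) (elems M) σ *ℚ coefficient (ordinary f) (elems M))
              (≢0-*ʳ {g a *ℚ 1/aut a} (subst (_≢ 0ℚ) (plethTerm-expansion a a≢0) ne))
    M = proj₁ found
    M∈ = proj₁ (proj₂ found)
    term≢0 = proj₂ (proj₂ found)

  rhsTerm-support : ∀ {a M} → rhsTerm f g σ (a , M) ≢ 0ℚ → a ∈ D × M ∈ multisetsFor a
  rhsTerm-support {a} {M} ne = proj₁ support , ∈-multisets⁺ (length (slots a)) len (proj₂ support)
    where
    valid = valid-support {a} {M} ne
    conjuncts = Equivalence.to (T-∧ {not (isZeroΛ a)}) valid
    a≢0 : a ≢ 0Λ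
    a≢0 refl = proj₁ conjuncts
    len|a| : length (elems M) ≡ ∣ a ∣Λ
    len|a| = ℕₚ.≡ᵇ⇒≡ _ _ (proj₁ (Equivalence.to (T-∧ {length (elems M) ℕ.≡ᵇ ∣ a ∣Λ}) (proj₂ conjuncts)))
    len : length (elems M) ≡ length (slots a)
    len = trans len|a| (sym (length-slots a))
    support = term-support M len (≢0-*ʳ {g a *ℚ 1/aut a} (≢0-*ʳ {fromℕ (aut σ)} (subst (_≢ 0ℚ) (rhsTerm-matched a M a≢0 len|a|) ne)))

mainTheorem5 : (σ : Λ) → σ ≢ 0Λ → (f g : PowerSeries) →
    Σ ℚ (λ c → PlethCoeff f g σ c × HasSum (rhsTerm f g σ) c)
mainTheorem5 σ _ f g =
  fromℕ (aut σ) *ℚ ∑ D (plethTerm f g σ) ,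
  (∑ D (plethTerm f g σ) , (D , uD , (λ _ → plethTerm-support f g σ) , refl) , refl) ,
  (dependentPairs D (multisetsFor f g σ) ,
   Unique-dependentPairs (multisetsFor f g σ) uD (λ a → Unique-multisets (length (slots a)) uD) ,
   (λ _ ne → Data.Product.uncurry (∈-dependentPairs⁺ (multisetsFor f g σ)) (rhsTerm-support f g σ ne)) ,
   (begin
     ∑ (dependentPairs D (multisetsFor f g σ)) (rhsTerm f g σ)
       ≡⟨ ∑-dependentPairs D (multisetsFor f g σ) (λ a M → rhsTerm f g σ (a , M)) ⟩
     ∑ D (λ a → ∑ (multisetsFor f g σ a) (λ M → rhsTerm f g σ (a , M)))
       ≡⟨ ∑-cong D (λ {a} _ → ∑-rhsTerm f g σ a) ⟩
     ∑ D (λ a → fromℕ (aut σ) *ℚ plethTerm f g σ a)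
       ≡⟨ ∑-*ˡ D (fromℕ (aut σ)) (plethTerm f g σ) ⟩
     fromℕ (aut σ) *ℚ ∑ D (plethTerm f g σ)
       ∎))
  where
  open ≡-Reasoning
  D = lighter (weight σ)
  uD = Unique-lighter (weight σ)
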